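{- Let $k$ be a positive multiple of $4$ and let $n$ be a positive integer. Then \[ \Phi_k(n)= n^{k/2-1} \mathbf{J}_{k/2}(n)\, \varphi(n)\, \frac{2^{k/2}}{2^{k/2}-1+(n \bmod 2)}, \] where $n\bmod 2\in\{0,1\}$ is the remainder of $n$ upon division by $2$. Moreover, if $k/4$ is odd, then \[ \frac{\Phi_{k}(n)}{\Phi_{k/4}(n)}=n^{k/4} \mathbf{J}_{k/2}(n) \frac{2^{k/2}}{2^{k/2}-1+(n\bmod 2)}. \]
   Context: For positive integers $k,n$, $\Phi_k(n)$ denotes the number of $k$-tuples $(x_1,\ldots,x_k)\in(\mathbb{Z}/n\mathbb{Z})^k$ such that $\gcd(x_1^2+\cdots+x_k^2,n)=1$. $\varphi$ is Euler's totient function, and $\mathbf{J}_m$ is Jordan's totient function, $\mathbf{J}_m(n)=n^m\prod_{p\mid n}(1-p^{ -m})$. -}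

module Defs where

open import Data.Nat as ℕ using (ℕ; zero; suc; _≟_)
open import Data.Nat.GCD using (gcd)
open import Data.Nat.Primality using (prime?)
open import Data.Nat.Divisibility using (_∣?_)
open import Data.List using (List; []; _∷_; [_]; map; concatMap; length; filter; upTo; foldr)
open import Data.Nat.ListAction using (sum)
open import Data.Integer using (+_)
open import Data.Rational as ℚ using (ℚ; 0ℚ; 1ℚ; _÷_; ≢-nonZero)
open import Data.Rational.Properties as ℚP using ()
open import Relation.Nullary using (yes; no)
open import Relation.Nullary.Decidable using (_×-dec_)

-- All k-tuples of residues 0,…,n-1 (representatives of ℤ/nℤ), as lists of length k.
tuples : ℕ → ℕ → List (List ℕ)
tuples zero    n = [ [] ]
tuples (suc k) n = concatMap (λ x → map (x ∷_) (tuples k n)) (upTo n)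

Φ : ℕ → ℕ → ℕ
Φ k n = length (filter (λ xs → gcd (sum (map (λ x → x ℕ.* x) xs)) n ≟ 1) (tuples k n))

φ : ℕ → ℕ
φ n = length (filter (λ x → gcd (suc x) n ≟ 1) (upTo n))

-- Total division on ℚ (value irrelevant when the divisor is 0; never used that way here).
_⊘_ : ℚ → ℚ → ℚ
p ⊘ q with q ℚP.≟ 0ℚ
... | yes _ = 0ℚ
... | no q≢0 = _÷_ p q {{≢-nonZero q≢0}}

fromℕ : ℕ → ℚ
fromℕ n = (+ n) ℚ./ 1

primeDivisors : ℕ → List ℕ
primeDivisors n = filter (λ p → prime? p ×-dec (p ∣? n)) (upTo (suc n))

J : ℕ → ℕ → ℚ
J m n = fromℕ (n ℕ.^ m) ℚ.* foldr (λ p acc → (1ℚ ℚ.- (1ℚ ⊘ fromℕ (p ℕ.^ m))) ℚ.* acc) 1ℚ (primeDivisors n)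

module Submission where

-- Writing χ_n for the indicator of units mod n, Φ_k(n) = Σ_{x ∈ (ℤ/n)ᵏ} χ_n(x₁² + ⋯ + xₖ²)
-- (SquareSums, Indicator).  The Chinese remainder theorem in summation form (ResidueSums)
-- makes Φ_k multiplicative in n, and lifting from p to pᵉ⁺¹ gives Φ_k(pᵉ⁺¹) = p^{ek}·N_p(k),
-- where N_p(k) counts x ∈ 𝔽ₚᵏ with Σxᵢ² ≠ 0 (ArithmeticFunctions).
-- For p = 2, N_2(k) = 2ᵏ⁻¹ (PrimeSums).  For odd p, -1 is a sum of two squares
-- (MinusOneSquares), so z² + w² is equivalent to -(z² + w²) and four squares form two
-- hyperbolic planes x² - y², whose value distribution is explicit (HyperbolicPlane); this yields
-- N_p(k) in closed form for k odd and for 4 ∣ k (OddPrimeCounts).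
-- Jordan's totient is multiplicative with known values at prime powers (Jordan).
-- Finally both sides of the formula are multiplicative and agree on prime powers
-- (Factorisation, MainFormula); the ratio Φ_k/Φ_{k/4} follows from Φ_{2i+1}(n) = n²ⁱφ(n).

module FiniteSums where

  open import Data.Nat using (ℕ; zero; suc; _+_; _*_; _<_; z≤n; s≤s)
  open import Data.Nat.Properties
  open import Relation.Binary.PropositionalEquality
  open import Data.Nat.Tactic.RingSolver using (solve-∀)

  ∑ : ℕ → (ℕ → ℕ) → ℕ
  ∑ zero    f = 0
  ∑ (suc n) f = f 0 + ∑ n (λ x → f (suc x))

  ∑-cong : ∀ n {f g : ℕ → ℕ} → (∀ x → f x ≡ g x) → ∑ n f ≡ ∑ n g
  ∑-cong zero    e = refl
  ∑-cong (suc n) e = cong₂ _+_ (e 0) (∑-cong n (λ x → e (suc x)))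

  ∑-congᵇ : ∀ n {f g : ℕ → ℕ} → (∀ x → x < n → f x ≡ g x) → ∑ n f ≡ ∑ n g
  ∑-congᵇ zero    e = refl
  ∑-congᵇ (suc n) e = cong₂ _+_ (e 0 (s≤s z≤n)) (∑-congᵇ n (λ x x<n → e (suc x) (s≤s x<n)))

  ∑-snoc : ∀ n f → ∑ (suc n) f ≡ ∑ n f + f n
  ∑-snoc zero    f = +-comm (f 0) 0
  ∑-snoc (suc n) f = trans (cong (f 0 +_) (∑-snoc n (λ x → f (suc x)))) (sym (+-assoc (f 0) _ _))

  ∑-+ : ∀ n f g → ∑ n (λ x → f x + g x) ≡ ∑ n f + ∑ n g
  ∑-+ zero    f g = refl
  ∑-+ (suc n) f g = trans (cong (f 0 + g 0 +_) (∑-+ n _ _)) (interchange (f 0) (g 0) _ _)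
    where
    interchange : ∀ a b c d → a + b + (c + d) ≡ a + c + (b + d)
    interchange = solve-∀

  ∑-* : ∀ n c f → ∑ n (λ x → c * f x) ≡ c * ∑ n f
  ∑-* zero    c f = sym (*-zeroʳ c)
  ∑-* (suc n) c f = trans (cong (c * f 0 +_) (∑-* n c _)) (sym (*-distribˡ-+ c (f 0) _))

  ∑-const : ∀ n c → ∑ n (λ _ → c) ≡ n * c
  ∑-const zero    c = refl
  ∑-const (suc n) c = cong (c +_) (∑-const n c)

  ∑-swap : ∀ m n (f : ℕ → ℕ → ℕ) → ∑ m (λ i → ∑ n (f i)) ≡ ∑ n (λ j → ∑ m (λ i → f i j))
  ∑-swap zero    n f = sym (trans (∑-const n 0) (*-zeroʳ n))
  ∑-swap (suc m) n f = trans (cong (∑ n (f 0) +_) (∑-swap m n (λ i → f (suc i))))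
                             (sym (∑-+ n (f 0) (λ j → ∑ m (λ i → f (suc i) j))))

  ∑-++ : ∀ m n f → ∑ (m + n) f ≡ ∑ m f + ∑ n (λ x → f (m + x))
  ∑-++ zero    n f = refl
  ∑-++ (suc m) n f = trans (cong (f 0 +_) (∑-++ m n (λ x → f (suc x)))) (sym (+-assoc (f 0) _ _))

  ∑-blocks : ∀ q m f → ∑ (q * m) f ≡ ∑ q (λ t → ∑ m (λ j → f (j + t * m)))
  ∑-blocks zero    m f = refl
  ∑-blocks (suc q) m f = trans (∑-++ m (q * m) f)
    (cong₂ _+_ (∑-cong m (λ j → cong f (sym (+-identityʳ j))))
      (trans (∑-blocks q m (λ x → f (m + x)))
        (∑-cong q (λ t → ∑-cong m (λ j → cong f (shift m j t))))))
    where
    shift : ∀ m j t → m + (j + t * m) ≡ j + (m + t * m)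
    shift = solve-∀

module Congruence where

  open import Data.Nat using (ℕ)
  open import Data.Integer using (ℤ; +_; 0ℤ; _+_; _*_; -_)
  open import Data.Product using (Σ)
  open import Relation.Binary.PropositionalEquality
  open import Data.Integer.Tactic.RingSolver using (solve-∀)

  -- a ≡[ n ] b : a ≡ b (mod n), with the quotient (a - b)/n as explicit witness.
  infix 4 _≡[_]_
  record _≡[_]_ (a : ℤ) (n : ℕ) (b : ℤ) : Set where
    constructor _,_
    field
      wit : ℤ
      eqn : a ≡ b + wit * + n

  infixr 4 _,_

  module _ {n : ℕ} where

    ≡⇒≡[] : ∀ {a b} → a ≡ b → a ≡[ n ] b
    ≡⇒≡[] {a} refl = 0ℤ , add-zero a (+ n)
      where
      add-zero : ∀ a n → a ≡ a + 0ℤ * n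
      add-zero = solve-∀

    ≡[]-refl : ∀ a → a ≡[ n ] a
    ≡[]-refl a = ≡⇒≡[] refl

    ≡[]-sym : ∀ {a b} → a ≡[ n ] b → b ≡[ n ] a
    ≡[]-sym {a} {b} (t , refl) = (- t) , cancel b t (+ n)
      where
      cancel : ∀ b t n → b ≡ b + t * n + - t * n
      cancel = solve-∀

    ≡[]-trans : ∀ {a b c} → a ≡[ n ] b → b ≡[ n ] c → a ≡[ n ] c
    ≡[]-trans {c = c} (t , refl) (u , refl) = u + t , collect c t u (+ n)
      where
      collect : ∀ c t u n → c + u * n + t * n ≡ c + (u + t) * n
      collect = solve-∀

    ≡[]-+ : ∀ {a b c d} → a ≡[ n ] b → c ≡[ n ] d → a + c ≡[ n ] b + d
    ≡[]-+ {b = b} {d = d} (t , refl) (u , refl) = t + u , collect b d t u (+ n)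
      where
      collect : ∀ b d t u n → b + t * n + (d + u * n) ≡ b + d + (t + u) * n
      collect = solve-∀

    ≡[]-* : ∀ {a b c d} → a ≡[ n ] b → c ≡[ n ] d → a * c ≡[ n ] b * d
    ≡[]-* {b = b} {d = d} (t , refl) (u , refl) =
      t * d + u * b + t * u * + n , expand b d t u (+ n)
      where
      expand : ∀ b d t u n → (b + t * n) * (d + u * n) ≡ b * d + (t * d + u * b + t * u * n) * n
      expand = solve-∀

    ≡[]-neg : ∀ {a b} → a ≡[ n ] b → - a ≡[ n ] - b
    ≡[]-neg {b = b} (t , refl) = (- t) , negate b t (+ n)
      where
      negate : ∀ b t n → - (b + t * n) ≡ - b + - t * n
      negate = solve-∀

  -- G is a function on ℤ/nℤ: it takes equal values on congruent integers.
  Periodic : ℕ → (ℤ → ℕ) → Set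
  Periodic n G = ∀ {a b} → a ≡[ n ] b → G a ≡ G b

  Periodic₂ : ℕ → (ℤ → ℤ → ℕ) → Set
  Periodic₂ n H = ∀ {a a' b b'} → a ≡[ n ] a' → b ≡[ n ] b' → H a b ≡ H a' b'

  Invertible : ℕ → ℤ → Set
  Invertible n c = Σ ℤ (λ c' → c * c' ≡[ n ] + 1)

module ResidueSums where

  open import Data.Nat as ℕ using (ℕ; zero; suc; NonZero)
  open import Data.Nat.Properties using (+-comm; +-cancelʳ-≡; *-cancelˡ-≡; *-comm)
  open import Data.Integer as ℤ using (ℤ; +_; -[1+_]; 0ℤ; 1ℤ)
  import Data.Integer.Properties as ℤP
  open import Data.Product using (_,_; proj₁; proj₂)
  open import Relation.Binary.PropositionalEquality
  open import Data.Nat.Coprimality using (Coprime; coprime-Bézout)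
  open import Data.Nat.GCD using (module Bézout)
  open import Data.Integer.Tactic.RingSolver using (solve-∀)
  open FiniteSums
  open Congruence

  ∑mod : ℕ → (ℤ → ℕ) → ℕ
  ∑mod n G = ∑ n (λ x → G (+ x))

  periodic-shift : ∀ n G d → Periodic n G → Periodic n (λ y → G (y ℤ.+ d))
  periodic-shift n G d per a≡b = per (≡[]-+ {n} a≡b (≡[]-refl d))

  -- Shifting the residue system by one: the term G n re-enters as G 0.
  ∑mod-shift-one : ∀ n G → Periodic n G → ∑ n (λ x → G (+ x ℤ.+ 1ℤ)) ≡ ∑mod n G
  ∑mod-shift-one n G per = +-cancelʳ-≡ (G 0ℤ) _ _ (begin
      ∑ n (λ x → G (+ x ℤ.+ 1ℤ)) ℕ.+ G 0ℤ
    ≡⟨ +-comm _ (G 0ℤ) ⟩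
      G 0ℤ ℕ.+ ∑ n (λ x → G (+ x ℤ.+ 1ℤ))
    ≡⟨ cong (G 0ℤ ℕ.+_) (∑-cong n (λ x → cong G (ℤP.+-comm (+ x) 1ℤ))) ⟩
      ∑ (suc n) (λ x → G (+ x))
    ≡⟨ ∑-snoc n _ ⟩
      ∑mod n G ℕ.+ G (+ n)
    ≡⟨ cong (∑mod n G ℕ.+_) (per (1ℤ , n≡0+1·n (+ n))) ⟩
      ∑mod n G ℕ.+ G 0ℤ ∎)
    where
    open ≡-Reasoning
    n≡0+1·n : ∀ n → n ≡ 0ℤ ℤ.+ 1ℤ ℤ.* n
    n≡0+1·n = solve-∀

  ∑mod-shift-nat : ∀ n G → Periodic n G → ∀ d k →
                   ∑ n (λ x → G (+ x ℤ.+ (d ℤ.+ + k))) ≡ ∑ n (λ x → G (+ x ℤ.+ d))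
  ∑mod-shift-nat n G per d zero    = ∑-cong n (λ x → cong (λ y → G (+ x ℤ.+ y)) (ℤP.+-identityʳ d))
  ∑mod-shift-nat n G per d (suc k) = begin
      ∑ n (λ x → G (+ x ℤ.+ (d ℤ.+ + suc k)))
    ≡⟨ ∑-cong n (λ x → cong G (regroup (+ x) d (+ k))) ⟩
      ∑ n (λ x → G (+ x ℤ.+ 1ℤ ℤ.+ (d ℤ.+ + k)))
    ≡⟨ ∑mod-shift-one n (λ y → G (y ℤ.+ (d ℤ.+ + k))) (periodic-shift n G _ per) ⟩
      ∑ n (λ x → G (+ x ℤ.+ (d ℤ.+ + k)))
    ≡⟨ ∑mod-shift-nat n G per d k ⟩
      ∑ n (λ x → G (+ x ℤ.+ d)) ∎
    where
    open ≡-Reasoning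
    regroup : ∀ x d k → x ℤ.+ (d ℤ.+ (1ℤ ℤ.+ k)) ≡ x ℤ.+ 1ℤ ℤ.+ (d ℤ.+ k)
    regroup = solve-∀

  ∑mod-shift : ∀ n G → Periodic n G → ∀ d → ∑ n (λ x → G (+ x ℤ.+ d)) ≡ ∑mod n G
  ∑mod-shift n G per (+ m)    =
    trans (∑mod-shift-nat n G per 0ℤ m) (∑-cong n (λ x → cong G (ℤP.+-identityʳ (+ x))))
  ∑mod-shift n G per -[1+ m ] = trans (sym (∑mod-shift-nat n G per -[1+ m ] (suc m)))
    (∑-cong n (λ x → cong G (trans (cong (λ z → + x ℤ.+ z) (ℤP.n⊖n≡0 (suc m))) (ℤP.+-identityʳ (+ x)))))

  -- Proof: S(j) = Σ_t G(j + c·t) satisfies S(j + 1) = S(j) (shift t by c⁻¹), so S is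
  -- constant; summing S(j) over j and exchanging the order gives n·S(0) = n·Σ G.
  module _ (n : ℕ) .{{_ : NonZero n}} (G : ℤ → ℕ) (per : Periodic n G)
           (c : ℤ) (c-unit : Invertible n c) where

    private
      c⁻¹ : ℤ
      c⁻¹ = proj₁ c-unit

      S : ℤ → ℕ
      S j = ∑ n (λ t → G (j ℤ.+ c ℤ.* + t))

      S-step : ∀ j → S (j ℤ.+ 1ℤ) ≡ S j
      S-step j = trans (∑-cong n (λ t → per (j+1+ct≡ t)))
                       (∑mod-shift n (λ y → G (j ℤ.+ c ℤ.* y)) per-j c⁻¹)
        where
        per-j : Periodic n (λ y → G (j ℤ.+ c ℤ.* y))
        per-j e = per (≡[]-+ {n} (≡[]-refl j) (≡[]-* {n} (≡[]-refl c) e))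
        distrib : ∀ j c t c' → j ℤ.+ c ℤ.* t ℤ.+ c ℤ.* c' ≡ j ℤ.+ c ℤ.* (t ℤ.+ c')
        distrib = solve-∀
        reorder : ∀ j ct → j ℤ.+ 1ℤ ℤ.+ ct ≡ j ℤ.+ ct ℤ.+ 1ℤ
        reorder = solve-∀
        j+1+ct≡ : ∀ t → j ℤ.+ 1ℤ ℤ.+ c ℤ.* + t ≡[ n ] j ℤ.+ c ℤ.* (+ t ℤ.+ c⁻¹)
        j+1+ct≡ t = ≡[]-trans {n} (≡⇒≡[] (reorder j (c ℤ.* + t)))
          (≡[]-trans {n} (≡[]-+ {n} (≡[]-refl (j ℤ.+ c ℤ.* + t)) (≡[]-sym {n} (proj₂ c-unit)))
            (≡⇒≡[] (distrib j c (+ t) c⁻¹)))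

      S-nat : ∀ j k → S (j ℤ.+ + k) ≡ S j
      S-nat j zero    = cong S (ℤP.+-identityʳ j)
      S-nat j (suc k) = trans (cong S (regroup j (+ k))) (trans (S-step (j ℤ.+ + k)) (S-nat j k))
        where
        regroup : ∀ j k → j ℤ.+ (1ℤ ℤ.+ k) ≡ j ℤ.+ k ℤ.+ 1ℤ
        regroup = solve-∀

      S-const : ∀ j → S j ≡ S 0ℤ
      S-const (+ m)    = S-nat 0ℤ m
      S-const -[1+ m ] = sym (trans (cong S (sym (ℤP.n⊖n≡0 (suc m)))) (S-nat -[1+ m ] (suc m)))

      n·S0 : n ℕ.* S 0ℤ ≡ n ℕ.* ∑mod n G
      n·S0 = begin
          n ℕ.* S 0ℤ
        ≡⟨ sym (∑-const n (S 0ℤ)) ⟩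
          ∑ n (λ j → S 0ℤ)
        ≡⟨ sym (∑-cong n (λ j → S-const (+ j))) ⟩
          ∑ n (λ j → ∑ n (λ t → G (+ j ℤ.+ c ℤ.* + t)))
        ≡⟨ ∑-swap n n _ ⟩
          ∑ n (λ t → ∑ n (λ j → G (+ j ℤ.+ c ℤ.* + t)))
        ≡⟨ ∑-cong n (λ t → ∑mod-shift n G per (c ℤ.* + t)) ⟩
          ∑ n (λ t → ∑mod n G)
        ≡⟨ ∑-const n _ ⟩
          n ℕ.* ∑mod n G ∎
        where open ≡-Reasoning

    ∑mod-affine : ∀ d → ∑ n (λ x → G (d ℤ.+ c ℤ.* + x)) ≡ ∑mod n G
    ∑mod-affine d = trans (S-const d) (*-cancelˡ-≡ _ _ n n·S0)

  coprime⇒invertible : ∀ m n → Coprime m n → Invertible n (+ m)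
  coprime⇒invertible m n cop with coprime-Bézout cop
  ... | Bézout.+- x y eq = + x , + y , (begin
      + m ℤ.* + x            ≡⟨ ℤP.pos-* m x ⟨
      + (m ℕ.* x)            ≡⟨ cong +_ (*-comm m x) ⟩
      + (x ℕ.* m)            ≡⟨ cong +_ eq ⟨
      + (1 ℕ.+ y ℕ.* n)      ≡⟨ ℤP.pos-+ 1 (y ℕ.* n) ⟩
      1ℤ ℤ.+ + (y ℕ.* n)     ≡⟨ cong (λ z → 1ℤ ℤ.+ z) (ℤP.pos-* y n) ⟩
      1ℤ ℤ.+ + y ℤ.* + n     ∎)
    where open ≡-Reasoning
  ... | Bézout.-+ x y eq = ℤ.- + x , ℤ.- + y , (begin
      + m ℤ.* ℤ.- + x               ≡⟨ negate (+ m) (+ x) ⟩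
      ℤ.- (1ℤ ℤ.+ + m ℤ.* + x) ℤ.+ 1ℤ ≡⟨ cong (λ z → ℤ.- z ℤ.+ 1ℤ) 1+mx≡yn ⟩
      ℤ.- (+ y ℤ.* + n) ℤ.+ 1ℤ     ≡⟨ rearrange (+ y) (+ n) ⟩
      1ℤ ℤ.+ ℤ.- + y ℤ.* + n       ∎)
    where
    open ≡-Reasoning
    negate : ∀ m x → m ℤ.* ℤ.- x ≡ ℤ.- (1ℤ ℤ.+ m ℤ.* x) ℤ.+ 1ℤ
    negate = solve-∀
    rearrange : ∀ y n → ℤ.- (y ℤ.* n) ℤ.+ 1ℤ ≡ 1ℤ ℤ.+ ℤ.- y ℤ.* n
    rearrange = solve-∀
    1+mx≡yn : 1ℤ ℤ.+ + m ℤ.* + x ≡ + y ℤ.* + n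
    1+mx≡yn = begin
      1ℤ ℤ.+ + m ℤ.* + x     ≡⟨ cong (λ z → 1ℤ ℤ.+ z) (ℤP.pos-* m x) ⟨
      1ℤ ℤ.+ + (m ℕ.* x)     ≡⟨ ℤP.pos-+ 1 (m ℕ.* x) ⟨
      + (1 ℕ.+ m ℕ.* x)      ≡⟨ cong (λ z → + (1 ℕ.+ z)) (*-comm m x) ⟩
      + (1 ℕ.+ x ℕ.* m)      ≡⟨ cong +_ eq ⟩
      + (y ℕ.* n)            ≡⟨ ℤP.pos-* y n ⟩
      + y ℤ.* + n            ∎

  block-entry : ∀ j t m → + (j ℕ.+ t ℕ.* m) ≡ + j ℤ.+ + m ℤ.* + t
  block-entry j t m = trans (ℤP.pos-+ j (t ℕ.* m))
    (cong (λ z → + j ℤ.+ z) (trans (ℤP.pos-* t m) (ℤP.*-comm (+ t) (+ m))))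

  block-entry-mod : ∀ j t m → + (j ℕ.+ t ℕ.* m) ≡[ m ] + j
  block-entry-mod j t m = + t , trans (block-entry j t m) (cong (λ z → + j ℤ.+ z) (ℤP.*-comm (+ m) (+ t)))

  ∑mod-crt : ∀ a b .{{_ : NonZero a}} → Coprime b a → (G H : ℤ → ℕ) →
             Periodic a G → Periodic b H →
             ∑ (a ℕ.* b) (λ x → G (+ x) ℕ.* H (+ x)) ≡ ∑mod a G ℕ.* ∑mod b H
  ∑mod-crt a b cop G H perG perH = begin
      ∑ (a ℕ.* b) (λ x → G (+ x) ℕ.* H (+ x))
    ≡⟨ ∑-blocks a b _ ⟩
      ∑ a (λ t → ∑ b (λ j → G (+ (j ℕ.+ t ℕ.* b)) ℕ.* H (+ (j ℕ.+ t ℕ.* b))))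
    ≡⟨ ∑-cong a (λ t → ∑-cong b (λ j →
         cong₂ ℕ._*_ (cong G (block-entry j t b)) (perH (block-entry-mod j t b)))) ⟩
      ∑ a (λ t → ∑ b (λ j → G (+ j ℤ.+ + b ℤ.* + t) ℕ.* H (+ j)))
    ≡⟨ ∑-swap a b _ ⟩
      ∑ b (λ j → ∑ a (λ t → G (+ j ℤ.+ + b ℤ.* + t) ℕ.* H (+ j)))
    ≡⟨ ∑-cong b (λ j → trans (∑-cong a (λ t → *-comm _ (H (+ j)))) (∑-* a (H (+ j)) _)) ⟩
      ∑ b (λ j → H (+ j) ℕ.* ∑ a (λ t → G (+ j ℤ.+ + b ℤ.* + t)))
    ≡⟨ ∑-cong b (λ j → cong (H (+ j) ℕ.*_)
         (∑mod-affine a G perG (+ b) (coprime⇒invertible b a cop) (+ j))) ⟩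
      ∑ b (λ j → H (+ j) ℕ.* ∑mod a G)
    ≡⟨ ∑-cong b (λ j → *-comm (H (+ j)) _) ⟩
      ∑ b (λ j → ∑mod a G ℕ.* H (+ j))
    ≡⟨ ∑-* b (∑mod a G) (λ j → H (+ j)) ⟩
      ∑mod a G ℕ.* ∑mod b H ∎
    where open ≡-Reasoning

  ∑mod-periods : ∀ q m (G : ℤ → ℕ) → Periodic m G → ∑ (q ℕ.* m) (λ x → G (+ x)) ≡ q ℕ.* ∑mod m G
  ∑mod-periods q m G per = trans (∑-blocks q m _)
    (trans (∑-cong q (λ t → ∑-cong m (λ j → per (block-entry-mod j t m)))) (∑-const q _))

  -- Solving the first coordinate of (x, y) ↦ (αx + βy, γx + δy) for x, with y fixed and α a unit:
  -- substituting x = α⁻¹(u - βy) gives Σ_x H(αx + βy, γx + δy) = Σ_u H(u, γα⁻¹u + (δ - γα⁻¹β)y).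
  ∑-solve-first : ∀ n .{{_ : NonZero n}} (H : ℤ → ℤ → ℕ) → Periodic₂ n H →
    ∀ α α⁻¹ β γ δ → α ℤ.* α⁻¹ ≡[ n ] 1ℤ → ∀ y →
    ∑ n (λ u → H (+ u) (γ ℤ.* α⁻¹ ℤ.* + u ℤ.+ (δ ℤ.- γ ℤ.* α⁻¹ ℤ.* β) ℤ.* y))
      ≡ ∑ n (λ x → H (α ℤ.* + x ℤ.+ β ℤ.* y) (γ ℤ.* + x ℤ.+ δ ℤ.* y))
  ∑-solve-first n H per α α⁻¹ β γ δ αα⁻¹≡1 y = trans
    (∑-cong n (λ u → per (≡[]-sym {n} (first-coord (+ u))) (≡⇒≡[] (sym (expand γ α⁻¹ β δ (+ u) y)))))
    (∑mod-affine n (λ t → H (α ℤ.* t ℤ.+ β ℤ.* y) (γ ℤ.* t ℤ.+ δ ℤ.* y))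
      (λ e → per (≡[]-+ {n} (≡[]-* {n} (≡[]-refl α) e) (≡[]-refl (β ℤ.* y)))
                 (≡[]-+ {n} (≡[]-* {n} (≡[]-refl γ) e) (≡[]-refl (δ ℤ.* y))))
      α⁻¹ (α , subst (_≡[ n ] 1ℤ) (ℤP.*-comm α α⁻¹) αα⁻¹≡1) (ℤ.- (α⁻¹ ℤ.* β ℤ.* y)))
    where
    regroup : ∀ α α⁻¹ β u y → α ℤ.* (ℤ.- (α⁻¹ ℤ.* β ℤ.* y) ℤ.+ α⁻¹ ℤ.* u) ℤ.+ β ℤ.* y
                              ≡ α ℤ.* α⁻¹ ℤ.* (u ℤ.- β ℤ.* y) ℤ.+ β ℤ.* y
    regroup = solve-∀
    cancel : ∀ u v → 1ℤ ℤ.* (u ℤ.- v) ℤ.+ v ≡ u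
    cancel = solve-∀
    expand : ∀ γ α⁻¹ β δ u y → γ ℤ.* (ℤ.- (α⁻¹ ℤ.* β ℤ.* y) ℤ.+ α⁻¹ ℤ.* u) ℤ.+ δ ℤ.* y
                               ≡ γ ℤ.* α⁻¹ ℤ.* u ℤ.+ (δ ℤ.- γ ℤ.* α⁻¹ ℤ.* β) ℤ.* y
    expand = solve-∀
    first-coord : ∀ u → α ℤ.* (ℤ.- (α⁻¹ ℤ.* β ℤ.* y) ℤ.+ α⁻¹ ℤ.* u) ℤ.+ β ℤ.* y ≡[ n ] u
    first-coord u = ≡[]-trans {n} (≡⇒≡[] (regroup α α⁻¹ β u y))
      (≡[]-trans {n} (≡[]-+ {n} (≡[]-* {n} αα⁻¹≡1 (≡[]-refl (u ℤ.- β ℤ.* y))) (≡[]-refl (β ℤ.* y)))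
                     (≡⇒≡[] (cancel u (β ℤ.* y))))

  -- Change of variables in a double sum by a linear map (x, y) ↦ (αx + βy, γx + δy) of ℤ/nℤ²,
  -- where α is a unit and so is the Schur complement Δ = δ - γα⁻¹β (so the map is invertible):
  -- solve for x in the inner sum, then substitute y ↦ Δ⁻¹(v - γα⁻¹u).
  ∑₂-linear : ∀ n .{{_ : NonZero n}} (H : ℤ → ℤ → ℕ) → Periodic₂ n H →
    ∀ α α⁻¹ β γ δ → α ℤ.* α⁻¹ ≡[ n ] 1ℤ → Invertible n (δ ℤ.- γ ℤ.* α⁻¹ ℤ.* β) →
    ∑ n (λ x → ∑ n (λ y → H (α ℤ.* + x ℤ.+ β ℤ.* + y) (γ ℤ.* + x ℤ.+ δ ℤ.* + y)))
      ≡ ∑ n (λ x → ∑ n (λ y → H (+ x) (+ y)))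
  ∑₂-linear n H per α α⁻¹ β γ δ αα⁻¹≡1 Δ-unit = begin
      ∑ n (λ x → ∑ n (λ y → H (α ℤ.* + x ℤ.+ β ℤ.* + y) (γ ℤ.* + x ℤ.+ δ ℤ.* + y)))
    ≡⟨ ∑-swap n n _ ⟩
      ∑ n (λ y → ∑ n (λ x → H (α ℤ.* + x ℤ.+ β ℤ.* + y) (γ ℤ.* + x ℤ.+ δ ℤ.* + y)))
    ≡⟨ ∑-cong n (λ y → ∑-solve-first n H per α α⁻¹ β γ δ αα⁻¹≡1 (+ y)) ⟨
      ∑ n (λ y → ∑ n (λ u → H (+ u) (γ ℤ.* α⁻¹ ℤ.* + u ℤ.+ Δ ℤ.* + y)))
    ≡⟨ ∑-swap n n _ ⟩
      ∑ n (λ u → ∑ n (λ y → H (+ u) (γ ℤ.* α⁻¹ ℤ.* + u ℤ.+ Δ ℤ.* + y)))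
    ≡⟨ ∑-cong n (λ u → ∑mod-affine n (H (+ u)) (per (≡[]-refl (+ u))) Δ Δ-unit (γ ℤ.* α⁻¹ ℤ.* + u)) ⟩
      ∑ n (λ x → ∑ n (λ y → H (+ x) (+ y))) ∎
    where
    open ≡-Reasoning
    Δ : ℤ
    Δ = δ ℤ.- γ ℤ.* α⁻¹ ℤ.* β

module SquareSums where

  open import Data.Nat as ℕ using (ℕ; zero; suc; _+_; _*_; _^_; NonZero)
  open import Data.Nat.Properties using (+-identityʳ; *-assoc; *-comm)
  open import Data.Integer as ℤ using (ℤ; +_)
  open import Relation.Binary.PropositionalEquality
  open import Data.Nat.Coprimality using (Coprime)
  open FiniteSums
  open Congruence
  open ResidueSums

  -- SqSum n k G s = Σ_{x ∈ {0,…,n-1}ᵏ} G(s + x₁² + ⋯ + xₖ²).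
  -- With G the indicator of units mod n and s = 0 this counts Φ_k(n).
  SqSum : ℕ → ℕ → (ℤ → ℕ) → ℤ → ℕ
  SqSum n zero    G s = G s
  SqSum n (suc k) G s = ∑ n (λ x → SqSum n k G (s ℤ.+ + x ℤ.* + x))

  SqSum-cong : ∀ n k {G G' : ℤ → ℕ} → (∀ z → G z ≡ G' z) → ∀ s → SqSum n k G s ≡ SqSum n k G' s
  SqSum-cong n zero    G≡G' s = G≡G' s
  SqSum-cong n (suc k) G≡G' s = ∑-cong n (λ x → SqSum-cong n k G≡G' _)

  SqSum-periodic : ∀ m n k G → Periodic m G → Periodic m (SqSum n k G)
  SqSum-periodic m n zero    G per e = per e
  SqSum-periodic m n (suc k) G per e =
    ∑-cong n (λ x → SqSum-periodic m n k G per (≡[]-+ {m} e (≡[]-refl (+ x ℤ.* + x))))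

  square-periodic : ∀ m (G : ℤ → ℕ) → Periodic m G → ∀ s → Periodic m (λ y → G (s ℤ.+ y ℤ.* y))
  square-periodic m G per s e = per (≡[]-+ {m} (≡[]-refl s) (≡[]-* {m} e e))

  SqSum-+ : ∀ n k l G s → SqSum n (k + l) G s ≡ SqSum n k (SqSum n l G) s
  SqSum-+ n zero    l G s = refl
  SqSum-+ n (suc k) l G s = ∑-cong n (λ x → SqSum-+ n k l G _)

  -- Averaging over the shift s: every variable contributes a free factor n.
  ∑mod-SqSum : ∀ n l G → Periodic n G → ∑mod n (SqSum n l G) ≡ n ^ l * ∑mod n G
  ∑mod-SqSum n zero    G per = sym (+-identityʳ (∑mod n G))
  ∑mod-SqSum n (suc l) G per = begin
      ∑ n (λ c → ∑ n (λ x → SqSum n l G (+ c ℤ.+ + x ℤ.* + x)))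
    ≡⟨ ∑-swap n n _ ⟩
      ∑ n (λ x → ∑ n (λ c → SqSum n l G (+ c ℤ.+ + x ℤ.* + x)))
    ≡⟨ ∑-cong n (λ x → ∑mod-shift n (SqSum n l G) (SqSum-periodic n n l G per) (+ x ℤ.* + x)) ⟩
      ∑ n (λ x → ∑mod n (SqSum n l G))
    ≡⟨ ∑-const n _ ⟩
      n * ∑mod n (SqSum n l G)
    ≡⟨ cong (n *_) (∑mod-SqSum n l G per) ⟩
      n * (n ^ l * ∑mod n G)
    ≡⟨ *-assoc n _ _ ⟨
      n * n ^ l * ∑mod n G ∎
    where open ≡-Reasoning

  SqSum-crt : ∀ a b .{{_ : NonZero a}} → Coprime b a → (G H : ℤ → ℕ) →
              Periodic a G → Periodic b H → ∀ k s →
              SqSum (a * b) k (λ z → G z * H z) s ≡ SqSum a k G s * SqSum b k H s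
  SqSum-crt a b cop G H perG perH zero    s = refl
  SqSum-crt a b cop G H perG perH (suc k) s =
    trans (∑-cong (a * b) (λ x → SqSum-crt a b cop G H perG perH k _))
      (∑mod-crt a b cop (λ y → SqSum a k G (s ℤ.+ y ℤ.* y)) (λ y → SqSum b k H (s ℤ.+ y ℤ.* y))
        (square-periodic a (SqSum a k G) (SqSum-periodic a a k G perG) s)
        (square-periodic b (SqSum b k H) (SqSum-periodic b b k H perH) s))

  SqSum-periods : ∀ q m G → Periodic m G → ∀ k s → SqSum (q * m) k G s ≡ q ^ k * SqSum m k G s
  SqSum-periods q m G per zero    s = sym (+-identityʳ _)
  SqSum-periods q m G per (suc k) s = begin
      ∑ (q * m) (λ x → SqSum (q * m) k G (s ℤ.+ + x ℤ.* + x))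
    ≡⟨ ∑-cong (q * m) (λ x → SqSum-periods q m G per k _) ⟩
      ∑ (q * m) (λ x → q ^ k * SqSum m k G (s ℤ.+ + x ℤ.* + x))
    ≡⟨ ∑-* (q * m) (q ^ k) _ ⟩
      q ^ k * ∑ (q * m) (λ x → SqSum m k G (s ℤ.+ + x ℤ.* + x))
    ≡⟨ cong (q ^ k *_) (∑mod-periods q m (λ y → SqSum m k G (s ℤ.+ y ℤ.* y))
          (square-periodic m (SqSum m k G) (SqSum-periodic m m k G per) s)) ⟩
      q ^ k * (q * SqSum m (suc k) G s)
    ≡⟨ *-assoc (q ^ k) q _ ⟨
      q ^ k * q * SqSum m (suc k) G s
    ≡⟨ cong (_* SqSum m (suc k) G s) (*-comm (q ^ k) q) ⟩
      q * q ^ k * SqSum m (suc k) G s ∎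
    where open ≡-Reasoning

module ListCounting where

  open import Data.Nat using (ℕ; zero; suc; _+_)
  open import Data.Bool using (true; false; if_then_else_)
  open import Data.List using (List; []; _∷_; map; concatMap; length; filter; applyUpTo; _++_)
  open import Data.List.Properties using (length-++; filter-++)
  open import Relation.Binary.PropositionalEquality
  open import Relation.Nullary using (does)
  open import Relation.Unary using (Pred; Decidable)
  open FiniteSums

  indicator : ∀ {a p} {A : Set a} {P : Pred A p} → Decidable P → A → ℕ
  indicator P? x = if does (P? x) then 1 else 0

  module _ {a p} {A : Set a} {P : Pred A p} (P? : Decidable P) where

    count-∷ : ∀ x xs → length (filter P? (x ∷ xs)) ≡ indicator P? x + length (filter P? xs)
    count-∷ x xs with does (P? x)
    ... | true  = refl
    ... | false = refl

    count-++ : ∀ xs ys → length (filter P? (xs ++ ys)) ≡ length (filter P? xs) + length (filter P? ys)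
    count-++ xs ys = trans (cong length (filter-++ P? xs ys)) (length-++ (filter P? xs))

    count-applyUpTo : ∀ (f : ℕ → A) n → length (filter P? (applyUpTo f n)) ≡ ∑ n (λ x → indicator P? (f x))
    count-applyUpTo f zero    = refl
    count-applyUpTo f (suc n) =
      trans (count-∷ (f 0) _) (cong (λ c → indicator P? (f 0) + c) (count-applyUpTo (λ x → f (suc x)) n))

    count-concatMap : ∀ (g : ℕ → List A) (f : ℕ → ℕ) n →
      length (filter P? (concatMap g (applyUpTo f n))) ≡ ∑ n (λ x → length (filter P? (g (f x))))
    count-concatMap g f zero    = refl
    count-concatMap g f (suc n) = trans (count-++ (g (f 0)) _)
      (cong (λ c → length (filter P? (g (f 0))) + c) (count-concatMap g (λ x → f (suc x)) n))

  count-map : ∀ {a b p} {A : Set a} {B : Set b} {P : Pred A p} (P? : Decidable P) (g : B → A) xs →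
              length (filter P? (map g xs)) ≡ length (filter (λ x → P? (g x)) xs)
  count-map P? g []       = refl
  count-map P? g (x ∷ xs) = trans (count-∷ P? (g x) (map g xs))
    (trans (cong (λ c → indicator P? (g x) + c) (count-map P? g xs)) (sym (count-∷ (λ x → P? (g x)) x xs)))

  count-cong : ∀ {a p q} {A : Set a} {P : Pred A p} {Q : Pred A q} (P? : Decidable P) (Q? : Decidable Q) →
               (∀ x → does (P? x) ≡ does (Q? x)) → ∀ xs → length (filter P? xs) ≡ length (filter Q? xs)
  count-cong P? Q? same []       = refl
  count-cong P? Q? same (x ∷ xs) = trans (count-∷ P? x xs)
    (trans (cong₂ _+_ (cong (λ b → if b then 1 else 0) (same x)) (count-cong P? Q? same xs))
           (sym (count-∷ Q? x xs)))

module Indicator where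

  open import Data.Nat as ℕ using (ℕ; zero; suc; _+_; _*_; _^_; _<_; z≤n; s≤s; _≟_)
  open import Data.Nat.Properties using (+-identityʳ; +-assoc; *-zeroʳ; *-identityʳ)
  open import Data.Integer as ℤ using (ℤ; +_; 0ℤ; 1ℤ)
  import Data.Integer.Properties as ℤP
  import Data.Integer.Divisibility.Signed as ℤD
  open import Data.Product using (_,_)
  open import Data.Sum using (inj₁; inj₂)
  open import Data.Empty using (⊥-elim)
  open import Data.List using (List; []; _∷_; map; concatMap; length; filter; upTo)
  open import Data.Nat.ListAction using (sum)
  open import Relation.Binary.PropositionalEquality
  open import Relation.Nullary using (Dec; yes; no; does; ¬_)
  open import Relation.Nullary.Decidable using (dec-true; dec-false)
  open import Data.Nat.GCD using (gcd)
  open import Data.Nat.Coprimality as C using (Coprime; gcd≡1⇒coprime; coprime⇒gcd≡1; coprime-divisor)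
  open import Data.Nat.Divisibility using (_∣_; ∣-trans; ∣m⇒∣m*n; ∣n⇒∣m*n; ∣-refl)
  open import Data.Nat.Primality using (Prime; prime⇒irreducible; prime⇒nonTrivial)
  open import Data.Nat.Base using (nonTrivial⇒≢1)
  open import Defs using (tuples; Φ; φ)
  open FiniteSums
  open Congruence
  open ResidueSums
  open SquareSums
  open ListCounting

  χℕ : ℕ → ℕ → ℕ
  χℕ n = indicator (λ y → gcd y n ≟ 1)

  χ : ℕ → ℤ → ℕ
  χ n z = χℕ n ℤ.∣ z ∣

  χℕ-coprime : ∀ {n y} → Coprime y n → χℕ n y ≡ 1
  χℕ-coprime {n} {y} cop rewrite dec-true (gcd y n ≟ 1) (coprime⇒gcd≡1 cop) = refl

  χℕ-¬coprime : ∀ {n y} → ¬ Coprime y n → χℕ n y ≡ 0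
  χℕ-¬coprime {n} {y} ¬cop rewrite dec-false (gcd y n ≟ 1) (λ g → ¬cop (gcd≡1⇒coprime g)) = refl

  χℕ-iff : ∀ n a b → (Coprime a n → Coprime b n) → (Coprime b n → Coprime a n) → χℕ n a ≡ χℕ n b
  χℕ-iff n a b a⇒b b⇒a with C.coprime? a n
  ... | yes cop = trans (χℕ-coprime cop) (sym (χℕ-coprime (a⇒b cop)))
  ... | no ¬cop = trans (χℕ-¬coprime ¬cop) (sym (χℕ-¬coprime (λ cop → ¬cop (b⇒a cop))))

  coprime-≡[] : ∀ {n a b} → a ≡[ n ] b → Coprime ℤ.∣ a ∣ n → Coprime ℤ.∣ b ∣ n
  coprime-≡[] {n} {a} {b} (t , a≡b+tn) cop {d} (d∣b , d∣n) = cop (ℤD.∣⇒∣ᵤ {+ d} {a} d∣a , d∣n)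
    where
    d∣a : + d ℤD.∣ a
    d∣a = subst (+ d ℤD.∣_) (sym a≡b+tn)
            (ℤD.∣m∣n⇒∣m+n (ℤD.∣ᵤ⇒∣ {+ d} {b} d∣b) (ℤD.∣n⇒∣m*n t (ℤD.∣ᵤ⇒∣ {+ d} {+ n} d∣n)))

  χ-periodic : ∀ n → Periodic n (χ n)
  χ-periodic n {a} {b} a≡b = χℕ-iff n ℤ.∣ a ∣ ℤ.∣ b ∣
    (coprime-≡[] a≡b) (coprime-≡[] (≡[]-sym {n} a≡b))

  coprime-* : ∀ {y a b} → Coprime y a → Coprime y b → Coprime y (a * b)
  coprime-* {y} {a} ca cb {d} (d∣y , d∣ab) = cb (d∣y , coprime-divisor d⊥a d∣ab)
    where
    d⊥a : Coprime d a
    d⊥a (e∣d , e∣a) = ca (∣-trans e∣d d∣y , e∣a)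

  coprime-*ˡ : ∀ {y a b} → Coprime y (a * b) → Coprime y a
  coprime-*ˡ {b = b} cop (d∣y , d∣a) = cop (d∣y , ∣m⇒∣m*n b d∣a)

  coprime-*ʳ : ∀ {y a b} → Coprime y (a * b) → Coprime y b
  coprime-*ʳ {a = a} cop (d∣y , d∣b) = cop (d∣y , ∣n⇒∣m*n a d∣b)

  coprime-^ : ∀ {m p} → Coprime m p → ∀ e → Coprime m (p ^ e)
  coprime-^ cop zero    = C.sym (C.1-coprimeTo _)
  coprime-^ cop (suc e) = coprime-* cop (coprime-^ cop e)

  χℕ-* : ∀ a b y → χℕ (a * b) y ≡ χℕ a y * χℕ b y
  χℕ-* a b y with C.coprime? y a | C.coprime? y b
  ... | yes ca | yes cb = trans (χℕ-coprime (coprime-* ca cb))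
                                (sym (cong₂ _*_ (χℕ-coprime ca) (χℕ-coprime cb)))
  ... | no ¬ca | _      = trans (χℕ-¬coprime (λ c → ¬ca (coprime-*ˡ {b = b} c)))
                                (sym (cong (_* χℕ b y) (χℕ-¬coprime ¬ca)))
  ... | yes ca | no ¬cb = trans (χℕ-¬coprime (λ c → ¬cb (coprime-*ʳ {a = a} c)))
                                (sym (trans (cong (χℕ a y *_) (χℕ-¬coprime ¬cb)) (*-zeroʳ (χℕ a y))))

  χ-* : ∀ a b z → χ (a * b) z ≡ χ a z * χ b z
  χ-* a b z = χℕ-* a b ℤ.∣ z ∣

  χ-idem : ∀ n z → χ n z * χ n z ≡ χ n z
  χ-idem n z with C.coprime? ℤ.∣ z ∣ n
  ... | yes cop rewrite χℕ-coprime cop  = refl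
  ... | no ¬cop rewrite χℕ-¬coprime ¬cop = refl

  χ-1 : ∀ z → χ 1 z ≡ 1
  χ-1 z = χℕ-coprime (C.sym (C.1-coprimeTo ℤ.∣ z ∣))

  χ-^ : ∀ p e z → χ (p ^ suc e) z ≡ χ p z
  χ-^ p zero    z = trans (χ-* p 1 z) (trans (cong (χ p z *_) (χ-1 z)) (*-identityʳ _))
  χ-^ p (suc e) z = trans (χ-* p (p ^ suc e) z) (trans (cong (χ p z *_) (χ-^ p e z)) (χ-idem p z))

  prime∤⇒coprime : ∀ {p m} → Prime p → ¬ p ∣ m → Coprime m p
  prime∤⇒coprime pp p∤m {d} (d∣m , d∣p) with prime⇒irreducible pp d∣p
  ... | inj₁ d≡1 = d≡1
  ... | inj₂ refl = ⊥-elim (p∤m d∣m)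

  χℕ-prime-∤ : ∀ {p} → Prime p → ∀ m → ¬ p ∣ m → χℕ p m ≡ 1
  χℕ-prime-∤ pp m p∤m = χℕ-coprime (prime∤⇒coprime pp p∤m)

  χℕ-prime-∣ : ∀ {p} → Prime p → ∀ m → p ∣ m → χℕ p m ≡ 0
  χℕ-prime-∣ {p} pp m p∣m = χℕ-¬coprime (λ cop → nonTrivial⇒≢1 {{prime⇒nonTrivial pp}} (cop (p∣m , ∣-refl)))

  sumSq : List ℕ → ℕ
  sumSq xs = sum (map (λ x → x * x) xs)

  count-shifted : ∀ n k s → length (filter (λ xs → gcd (s + sumSq xs) n ≟ 1) (tuples k n))
                            ≡ SqSum n k (χ n) (+ s)
  count-shifted n zero    s = trans (count-∷ (λ xs → gcd (s + sumSq xs) n ≟ 1) [] [])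
    (trans (+-identityʳ _) (cong (χℕ n) (+-identityʳ s)))
  count-shifted n (suc k) s = begin
      length (filter P? (concatMap (λ x → map (x ∷_) (tuples k n)) (upTo n)))
    ≡⟨ count-concatMap P? (λ x → map (x ∷_) (tuples k n)) (λ x → x) n ⟩
      ∑ n (λ x → length (filter P? (map (x ∷_) (tuples k n))))
    ≡⟨ ∑-cong n (λ x → count-map P? (x ∷_) (tuples k n)) ⟩
      ∑ n (λ x → length (filter (λ xs → P? (x ∷ xs)) (tuples k n)))
    ≡⟨ ∑-cong n (λ x → count-cong _ _
         (λ xs → cong (λ m → does (gcd m n ≟ 1)) (sym (+-assoc s (x * x) (sumSq xs)))) (tuples k n)) ⟩
      ∑ n (λ x → length (filter (λ xs → gcd (s + x * x + sumSq xs) n ≟ 1) (tuples k n)))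
    ≡⟨ ∑-cong n (λ x → count-shifted n k (s + x * x)) ⟩
      ∑ n (λ x → SqSum n k (χ n) (+ (s + x * x)))
    ≡⟨ ∑-cong n (λ x → cong (SqSum n k (χ n))
         (trans (ℤP.pos-+ s (x * x)) (cong (λ z → + s ℤ.+ z) (ℤP.pos-* x x)))) ⟩
      SqSum n (suc k) (χ n) (+ s) ∎
    where
    open ≡-Reasoning
    P? : (xs : List ℕ) → Dec (gcd (s + sumSq xs) n ≡ 1)
    P? xs = gcd (s + sumSq xs) n ≟ 1

  Φ≡SqSum : ∀ k n → Φ k n ≡ SqSum n k (χ n) 0ℤ
  Φ≡SqSum k n = count-shifted n k 0

  -- φ(n) counts 1 ≤ x ≤ n, i.e. the residues x + 1 for 0 ≤ x < n; shift back by one.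
  φ≡∑mod : ∀ n → φ n ≡ ∑mod n (χ n)
  φ≡∑mod n = trans (count-applyUpTo (λ x → gcd (suc x) n ≟ 1) (λ x → x) n)
    (trans (∑-cong n (λ x → cong (χ n) (ℤP.+-comm 1ℤ (+ x)))) (∑mod-shift-one n (χ n) (χ-periodic n)))

  -- φ(n) > 0: the residue 1 is always counted.
  φ-pos : ∀ n → 0 < n → 0 < φ n
  φ-pos (suc n) _ = subst (0 <_) (sym (count-applyUpTo (λ x → gcd (suc x) (suc n) ≟ 1) (λ x → x) (suc n)))
    (subst (λ c → 0 < c + ∑ n (λ x → χℕ (suc n) (suc (suc x)))) (sym (χℕ-coprime (C.1-coprimeTo (suc n)))) (s≤s z≤n))

module PrimeSums where

  open import Data.Nat as ℕ using (ℕ; zero; suc; _+_; _*_; _∸_; _^_; _<_; s≤s; NonZero)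
  open import Data.Nat.Properties using (<⇒≱; *-identityʳ; +-identityʳ)
  open import Data.Integer as ℤ using (+_; -[1+_]; 0ℤ; 1ℤ)
  import Data.Integer.Properties as ℤP
  open import Data.Product using (_,_)
  open import Data.Sum using (_⊎_; inj₁; inj₂)
  open import Relation.Binary.PropositionalEquality
  open import Relation.Nullary using (¬_)
  open import Data.Nat.Divisibility using (_∣_; ∣⇒≤; _∣0)
  open import Data.Nat.Primality using (Prime; euclidsLemma; prime⇒nonZero)
  open FiniteSums
  open Congruence
  open ResidueSums
  open SquareSums
  open Indicator

  pred-suc : ∀ m → .{{NonZero m}} → m ≡ suc (m ∸ 1)
  pred-suc (suc m) = refl

  module _ (p : ℕ) (pp : Prime p) where

    private
      instance
        p≢0 : NonZero p
        p≢0 = prime⇒nonZero pp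

      p∤ : ∀ x → suc x < p → ¬ p ∣ suc x
      p∤ x lt p∣ = <⇒≱ lt (∣⇒≤ p∣)

      p∤² : ∀ x → suc x < p → ¬ p ∣ suc x * suc x
      p∤² x lt p∣ with euclidsLemma (suc x) (suc x) pp p∣
      ... | inj₁ h = p∤ x lt h
      ... | inj₂ h = p∤ x lt h

      ∑-punctured : ∀ (f : ℕ → ℕ) → f 0 ≡ 0 → (∀ x → suc x < p → f (suc x) ≡ 1) → ∑ p f ≡ p ∸ 1
      ∑-punctured f f0 f1 = begin
          ∑ p f                       ≡⟨ cong (λ m → ∑ m f) (pred-suc p) ⟩
          ∑ (suc (p ∸ 1)) f           ≡⟨ cong₂ _+_ f0 (∑-congᵇ (p ∸ 1) (λ x lt →
                                          f1 x (subst (suc x <_) (sym (pred-suc p)) (s≤s lt)))) ⟩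
          ∑ (p ∸ 1) (λ _ → 1)         ≡⟨ ∑-const (p ∸ 1) 1 ⟩
          (p ∸ 1) * 1                 ≡⟨ *-identityʳ (p ∸ 1) ⟩
          p ∸ 1                       ∎
        where open ≡-Reasoning

    ∑mod-χ-prime : ∑mod p (χ p) ≡ p ∸ 1
    ∑mod-χ-prime = ∑-punctured (λ x → χ p (+ x)) (χℕ-prime-∣ pp 0 (p ∣0))
                               (λ x lt → χℕ-prime-∤ pp (suc x) (p∤ x lt))

    -- x² is a unit mod p iff x is.
    ∑-χ-square : ∑ p (λ x → χ p (+ x ℤ.* + x)) ≡ p ∸ 1
    ∑-χ-square = ∑-punctured (λ x → χ p (+ x ℤ.* + x)) (χℕ-prime-∣ pp 0 (p ∣0))
      (λ x lt → trans (cong (χℕ p) (cong ℤ.∣_∣ (sym (ℤP.pos-* (suc x) (suc x)))))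
                      (χℕ-prime-∤ pp _ (p∤² x lt)))

    ∑-χ-neg-square : ∑ p (λ x → χ p (ℤ.- (+ x ℤ.* + x))) ≡ p ∸ 1
    ∑-χ-neg-square = trans (∑-cong p (λ x → cong (χℕ p) (ℤP.∣-i∣≡∣i∣ (+ x ℤ.* + x)))) ∑-χ-square

  parity : ∀ s → s ≡[ 2 ] 0ℤ ⊎ s ≡[ 2 ] 1ℤ
  parity (+ n)    = parityℕ n
    where
    parityℕ : ∀ n → + n ≡[ 2 ] 0ℤ ⊎ + n ≡[ 2 ] 1ℤ
    parityℕ zero    = inj₁ (≡[]-refl 0ℤ)
    parityℕ (suc n) with parityℕ n
    ... | inj₁ even = inj₂ (≡[]-trans {2} (≡⇒≡[] (ℤP.+-comm 1ℤ (+ n))) (≡[]-+ {2} even (≡[]-refl 1ℤ)))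
    ... | inj₂ odd  = inj₁ (≡[]-trans {2} (≡⇒≡[] (ℤP.+-comm 1ℤ (+ n)))
                             (≡[]-trans {2} (≡[]-+ {2} odd (≡[]-refl 1ℤ)) (1ℤ , refl)))
  parity -[1+ n ] with parity (+ suc n)
  ... | inj₁ even = inj₁ (≡[]-neg {2} even)
  ... | inj₂ odd  = inj₂ (≡[]-trans {2} (≡[]-neg {2} odd) (ℤ.- 1ℤ , refl))

  χ2-consecutive : ∀ s → χ 2 s + χ 2 (s ℤ.+ 1ℤ) ≡ 1
  χ2-consecutive s with parity s
  ... | inj₁ even = cong₂ _+_ (χ-periodic 2 even) (χ-periodic 2 (≡[]-+ {2} even (≡[]-refl 1ℤ)))
  ... | inj₂ odd  = cong₂ _+_ (χ-periodic 2 odd)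
                              (χ-periodic 2 (≡[]-trans {2} (≡[]-+ {2} odd (≡[]-refl 1ℤ)) two≡0))
    where
    two≡0 : 1ℤ ℤ.+ 1ℤ ≡[ 2 ] 0ℤ
    two≡0 = 1ℤ , refl

  SqSum-2 : ∀ k s → SqSum 2 (suc k) (χ 2) s ≡ 2 ^ k
  SqSum-2 zero    s = trans two-terms (χ2-consecutive s)
    where
    two-terms : SqSum 2 1 (χ 2) s ≡ χ 2 s + χ 2 (s ℤ.+ 1ℤ)
    two-terms = cong₂ _+_ (cong (χ 2) (ℤP.+-identityʳ s)) (+-identityʳ _)
  SqSum-2 (suc k) s = begin
      SqSum 2 (suc (suc k)) (χ 2) s
    ≡⟨ cong₂ _+_ (cong (SqSum 2 (suc k) (χ 2)) (ℤP.+-identityʳ s)) (+-identityʳ _) ⟩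
      SqSum 2 (suc k) (χ 2) s + SqSum 2 (suc k) (χ 2) (s ℤ.+ 1ℤ)
    ≡⟨ cong₂ _+_ (SqSum-2 k s) (SqSum-2 k (s ℤ.+ 1ℤ)) ⟩
      2 ^ k + 2 ^ k
    ≡⟨ cong (λ c → 2 ^ k + c) (sym (+-identityʳ (2 ^ k))) ⟩
      2 ^ suc k ∎
    where open ≡-Reasoning

module MinusOneSquares where

  open import Data.Nat as ℕ using (ℕ; zero; suc; _+_; _*_; _∸_; _<_; _≤_; z≤n; s≤s; NonZero; _%_; _/_; _<?_)
  open import Data.Nat.Properties
  open import Data.Nat.DivMod using (m≡m%n+[m/n]*n; m%n<n; m*n%n≡0)
  open import Data.Integer as ℤ using (ℤ; +_; 0ℤ; 1ℤ)
  import Data.Integer.Properties as ℤP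
  open import Data.Product using (Σ; _,_; _×_)
  open import Data.Sum using ([_,_]′)
  open import Data.Empty using (⊥; ⊥-elim)
  open import Relation.Binary.PropositionalEquality
  open import Relation.Nullary using (yes; no; ¬_; Dec)
  open import Data.Nat.Primality using (Prime; prime⇒nonZero; prime⇒nonTrivial; euclidsLemma)
  open import Data.Nat.Base using (nonTrivial⇒≢1)
  open import Data.Nat.Divisibility using (_∣_; divides; ∣⇒≤)
  open import Data.Fin using (toℕ; fromℕ<)
  open import Data.Fin.Properties using (pigeonhole; toℕ-fromℕ<; toℕ<n)
  open import Data.Integer.Tactic.RingSolver using (solve-∀)
  open import Data.Nat.Tactic.RingSolver renaming (solve-∀ to solveℕ-∀)
  open Congruence
  open ResidueSums
  open Indicator using (prime∤⇒coprime)

  -- The q + 1 residues x² (0 ≤ x ≤ q) are distinct, and so are the q + 1 residues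
  -- -1 - y²; as 2q + 2 > p, some x² ≡ -1 - y² (pigeonhole).
  module _ (p q : ℕ) (pp : Prime p) (p≡2q+1 : p ≡ suc (2 * q)) where

    private
      instance
        p≢0 : NonZero p
        p≢0 = prime⇒nonZero pp

      p≡suc[p∸1] : p ≡ suc (p ∸ 1)
      p≡suc[p∸1] = trans p≡2q+1 (sym (cong (λ z → suc (z ∸ 1)) p≡2q+1))

      ≡[]-% : ∀ x → + x ≡[ p ] + (x % p)
      ≡[]-% x = + (x / p) , trans (cong +_ (m≡m%n+[m/n]*n x p))
        (trans (ℤP.pos-+ (x % p) _) (cong (λ z → + (x % p) ℤ.+ z) (ℤP.pos-* (x / p) p)))

      %≡⇒≡[] : ∀ x y → x % p ≡ y % p → + x ≡[ p ] + y
      %≡⇒≡[] x y e = ≡[]-trans {p} (≡[]-% x) (subst (λ z → + z ≡[ p ] + y) (sym e) (≡[]-sym {p} (≡[]-% y)))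

      ≡[]0⇒∣ : ∀ m → + m ≡[ p ] 0ℤ → p ∣ m
      ≡[]0⇒∣ m (t , e) = divides ℤ.∣ t ∣
        (trans (cong ℤ.∣_∣ e) (trans (cong ℤ.∣_∣ (ℤP.+-identityˡ (t ℤ.* + p))) (ℤP.abs-* t (+ p))))

      ∤-small : ∀ m → 0 < m → m < p → ¬ p ∣ m
      ∤-small (suc m) _ m<p p∣m = <⇒≱ m<p (∣⇒≤ p∣m)

      ≤q⇒<p : ∀ a → a ≤ q → a < p
      ≤q⇒<p a a≤q = subst (a <_) (sym p≡2q+1) (s≤s (≤-trans a≤q (m≤m+n q (q + 0))))

      -- x² ≢ y² (mod p) for 0 ≤ x < y ≤ q, since p divides neither y - x nor x + y.
      squares-distinct : ∀ x y → x < y → y ≤ q → (x * x) % p ≡ (y * y) % p → ⊥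
      squares-distinct x y x<y y≤q e =
        [ ∤-small d (m<n⇒0<n∸m x<y) (≤-<-trans (m∸n≤m y x) (≤q⇒<p y y≤q))
        , ∤-small (x + y) (≤-trans (m<n⇒0<n∸m x<y) (≤-trans (m∸n≤m y x) (m≤n+m y x))) x+y<p
        ]′ (euclidsLemma d (x + y) pp (≡[]0⇒∣ _ d[x+y]≡0))
        where
        d : ℕ
        d = y ∸ x
        x+y<p : x + y < p
        x+y<p = subst (x + y <_) (sym p≡2q+1)
          (s≤s (≤-trans (+-mono-≤ (≤-trans (<⇒≤ x<y) y≤q) y≤q) (≤-reflexive (cong (λ z → q + z) (sym (+-identityʳ q))))))
        y≡x+d : y ≡ x + d
        y≡x+d = sym (m+[n∸m]≡n (<⇒≤ x<y))
        square-expand : ∀ x d → (x + d) * (x + d) ≡ x * x + d * (x + (x + d))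
        square-expand = solveℕ-∀
        y²≡x²+d[x+y] : y * y ≡ x * x + d * (x + y)
        y²≡x²+d[x+y] = trans (cong (λ z → z * z) y≡x+d)
          (trans (square-expand x d) (cong (λ z → x * x + d * (x + z)) (sym y≡x+d)))
        x²+d[x+y]≡x² : + (x * x + d * (x + y)) ≡[ p ] + (x * x)
        x²+d[x+y]≡x² = subst (λ z → + z ≡[ p ] + (x * x)) y²≡x²+d[x+y] (%≡⇒≡[] _ _ (sym e))
        cancel : ∀ a b → ℤ.- a ℤ.+ (a ℤ.+ b) ≡ b
        cancel = solve-∀
        d[x+y]≡0 : + (d * (x + y)) ≡[ p ] 0ℤ
        d[x+y]≡0 = subst₂ (λ u v → u ≡[ p ] v)
          (trans (cong (λ z → ℤ.- + (x * x) ℤ.+ z) (ℤP.pos-+ (x * x) _)) (cancel (+ (x * x)) _))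
          (ℤP.+-inverseˡ (+ (x * x)))
          (≡[]-+ {p} (≡[]-refl (ℤ.- + (x * x))) x²+d[x+y]≡x²)

      h : ℕ
      h = suc q

      -- The p + 1 values: x² mod p for x < h, and (p - 1) - ((x - h)² mod p) for h ≤ x ≤ p.
      value : ℕ → ℕ
      value x with x <? h
      ... | yes _ = (x * x) % p
      ... | no _  = p ∸ 1 ∸ ((x ∸ h) * (x ∸ h)) % p

      value-low : ∀ x → x < h → value x ≡ (x * x) % p
      value-low x x<h with x <? h
      ... | yes _ = refl
      ... | no x≮h = ⊥-elim (x≮h x<h)

      value-high : ∀ x → ¬ x < h → value x ≡ p ∸ 1 ∸ ((x ∸ h) * (x ∸ h)) % p
      value-high x x≮h with x <? h
      ... | yes x<h = ⊥-elim (x≮h x<h)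
      ... | no _ = refl

      value<p : ∀ x → value x < p
      value<p x with x <? h
      ... | yes _ = m%n<n _ p
      ... | no _  = subst (p ∸ 1 ∸ ((x ∸ h) * (x ∸ h)) % p <_) (sym p≡suc[p∸1])
                          (s≤s (m∸n≤m (p ∸ 1) (((x ∸ h) * (x ∸ h)) % p)))

      %≤p∸1 : ∀ m → m % p ≤ p ∸ 1
      %≤p∸1 m = ℕ.s≤s⁻¹ (subst (m % p <_) p≡suc[p∸1] (m%n<n m p))

      shifted≤q : ∀ y → y < suc p → y ∸ h ≤ q
      shifted≤q y y≤p = ≤-trans (∸-monoˡ-≤ h (ℕ.s≤s⁻¹ (subst (y <_) (cong suc p≡2q+1) y≤p)))
                                (≤-reflexive (trans (m+n∸m≡n q (q + 0)) (+-identityʳ q)))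

      -- Two indices x < y ≤ p with equal values: they must straddle h, giving x² + y'² + 1 ≡ 0.
      collision : ∀ x y → x < y → y < suc p → value x ≡ value y →
                  Σ ℕ λ a → Σ ℕ λ b → a ≤ q × b ≤ q × (a * a) % p + (b * b) % p + 1 ≡ p
      collision x y x<y y≤p e = by-cases (x <? h) (y <? h)
        where
        by-cases : Dec (x < h) → Dec (y < h) →
                   Σ ℕ λ a → Σ ℕ λ b → a ≤ q × b ≤ q × (a * a) % p + (b * b) % p + 1 ≡ p
        by-cases (yes x<h) (yes y<h) = ⊥-elim (squares-distinct x y x<y (ℕ.s≤s⁻¹ y<h)
          (trans (sym (value-low x x<h)) (trans e (value-low y y<h))))
        by-cases (yes x<h) (no y≮h) = x , y ∸ h , ℕ.s≤s⁻¹ x<h , shifted≤q y y≤p , sum≡p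
          where
          r : ℕ
          r = ((y ∸ h) * (y ∸ h)) % p
          x²≡ : (x * x) % p ≡ p ∸ 1 ∸ r
          x²≡ = trans (sym (value-low x x<h)) (trans e (value-high y y≮h))
          sum≡p : (x * x) % p + r + 1 ≡ p
          sum≡p = trans (cong (λ z → z + r + 1) x²≡)
            (trans (cong (λ z → z + 1) (m∸n+n≡m (%≤p∸1 _))) (trans (+-comm (p ∸ 1) 1) (sym p≡suc[p∸1])))
        by-cases (no x≮h) (yes y<h) = ⊥-elim (x≮h (<-trans x<y y<h))
        by-cases (no x≮h) (no y≮h) = ⊥-elim (squares-distinct (x ∸ h) (y ∸ h) (∸-monoˡ-< x<y (≮⇒≥ x≮h))
          (shifted≤q y y≤p)
          (∸-cancelˡ-≡ (%≤p∸1 _) (%≤p∸1 _) (trans (sym (value-high x x≮h)) (trans e (value-high y y≮h)))))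

      small-solution : Σ ℕ λ a → Σ ℕ λ b → a ≤ q × b ≤ q × (a * a) % p + (b * b) % p + 1 ≡ p
      small-solution with pigeonhole (n<1+n p) (λ i → fromℕ< (value<p (toℕ i)))
      ... | i , j , i<j , e = collision (toℕ i) (toℕ j) i<j (toℕ<n j)
        (trans (sym (toℕ-fromℕ< (value<p (toℕ i)))) (trans (cong toℕ e) (toℕ-fromℕ< (value<p (toℕ j)))))

      unit-small : ∀ a → suc a ≤ q → Invertible p (+ suc a)
      unit-small a le = coprime⇒invertible (suc a) p
        (prime∤⇒coprime pp (∤-small (suc a) (s≤s z≤n) (≤q⇒<p (suc a) le)))

      0%p≡0 : 0 % p ≡ 0
      0%p≡0 = m*n%n≡0 0 p

      sum≡-1 : ∀ a b → (a * a) % p + (b * b) % p + 1 ≡ p → + a ℤ.* + a ℤ.+ + b ℤ.* + b ≡[ p ] ℤ.- 1ℤ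
      sum≡-1 a b sum≡p = ≡[]-trans {p}
        (≡[]-+ {p} (subst (λ z → z ≡[ p ] + ((a * a) % p)) (ℤP.pos-* a a) (≡[]-% (a * a)))
                   (subst (λ z → z ≡[ p ] + ((b * b) % p)) (ℤP.pos-* b b) (≡[]-% (b * b))))
        (1ℤ , trans (move (+ ((a * a) % p) ℤ.+ + ((b * b) % p))) (cong (λ z → ℤ.- 1ℤ ℤ.+ 1ℤ ℤ.* z) X+1≡p))
        where
        X+1≡p : + ((a * a) % p) ℤ.+ + ((b * b) % p) ℤ.+ 1ℤ ≡ + p
        X+1≡p = trans (cong (ℤ._+ 1ℤ) (sym (ℤP.pos-+ ((a * a) % p) _))) (trans (sym (ℤP.pos-+ _ 1)) (cong +_ sum≡p))
        move : ∀ X → X ≡ ℤ.- 1ℤ ℤ.+ 1ℤ ℤ.* (X ℤ.+ 1ℤ)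
        move = solve-∀

    minus-one-sum-of-two-squares :
      Σ ℤ λ a → Σ ℤ λ b → Invertible p a × (a ℤ.* a ℤ.+ b ℤ.* b ≡[ p ] ℤ.- 1ℤ)
    minus-one-sum-of-two-squares with small-solution
    ... | suc a , b , a≤ , b≤ , sum≡p = + suc a , + b , unit-small a a≤ , sum≡-1 (suc a) b sum≡p
    ... | zero , suc b , a≤ , b≤ , sum≡p = + suc b , 0ℤ , unit-small b b≤ ,
            subst (_≡[ p ] ℤ.- 1ℤ) (swap (+ suc b ℤ.* + suc b)) (sum≡-1 zero (suc b) sum≡p)
      where
      swap : ∀ x → 0ℤ ℤ.* 0ℤ ℤ.+ x ≡ x ℤ.+ 0ℤ ℤ.* 0ℤ
      swap = solve-∀
    ... | zero , zero , a≤ , b≤ , sum≡p = ⊥-elim (nonTrivial⇒≢1 {{prime⇒nonTrivial pp}}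
            (trans (sym sum≡p) (cong (λ z → z + z + 1) 0%p≡0)))

module HyperbolicPlane where

  open import Data.Nat as ℕ using (ℕ; suc; _∸_; _<_; s≤s; NonZero)
  open import Data.Integer as ℤ using (ℤ; +_; 0ℤ; 1ℤ)
  import Data.Integer.Properties as ℤP
  open import Data.Nat.Properties using (<⇒≱)
  open import Data.Nat.Divisibility using (∣⇒≤)
  open import Data.Product using (_,_)
  open import Relation.Binary.PropositionalEquality
  open import Data.Nat.Primality using (Prime; prime⇒nonZero)
  open import Data.Integer.Tactic.RingSolver using (solve-∀)
  open FiniteSums
  open Congruence
  open ResidueSums
  open Indicator using (prime∤⇒coprime)
  open PrimeSums using (pred-suc)
  open MinusOneSquares

  -- If a² + b² ≡ -1 (mod n) then z² + w² ≡ -(az + bw)² - (bz - aw)², as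
  -- z² + w² = -(az + bw)² - (bz - aw)² + (a² + b² + 1)(z² + w²).
  rotation-negates : ∀ {n} a b → a ℤ.* a ℤ.+ b ℤ.* b ≡[ n ] ℤ.- 1ℤ → ∀ s z w →
    s ℤ.+ z ℤ.* z ℤ.+ w ℤ.* w ≡[ n ] s ℤ.- (a ℤ.* z ℤ.+ b ℤ.* w) ℤ.* (a ℤ.* z ℤ.+ b ℤ.* w)
                                       ℤ.- (b ℤ.* z ℤ.+ ℤ.- a ℤ.* w) ℤ.* (b ℤ.* z ℤ.+ ℤ.- a ℤ.* w)
  rotation-negates {n} a b a²+b²≡-1 s z w = ≡[]-trans {n} (≡⇒≡[] (identity s z w a b))
    (≡[]-trans {n} (≡[]-+ {n} (≡[]-refl X)
                              (≡[]-* {n} (≡[]-+ {n} a²+b²≡-1 (≡[]-refl 1ℤ)) (≡[]-refl (z ℤ.* z ℤ.+ w ℤ.* w))))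
                   (≡⇒≡[] (vanish X (z ℤ.* z ℤ.+ w ℤ.* w))))
    where
    X : ℤ
    X = s ℤ.- (a ℤ.* z ℤ.+ b ℤ.* w) ℤ.* (a ℤ.* z ℤ.+ b ℤ.* w)
          ℤ.- (b ℤ.* z ℤ.+ ℤ.- a ℤ.* w) ℤ.* (b ℤ.* z ℤ.+ ℤ.- a ℤ.* w)
    identity : ∀ s z w a b → s ℤ.+ z ℤ.* z ℤ.+ w ℤ.* w
      ≡ s ℤ.- (a ℤ.* z ℤ.+ b ℤ.* w) ℤ.* (a ℤ.* z ℤ.+ b ℤ.* w)
          ℤ.- (b ℤ.* z ℤ.+ ℤ.- a ℤ.* w) ℤ.* (b ℤ.* z ℤ.+ ℤ.- a ℤ.* w)
          ℤ.+ (a ℤ.* a ℤ.+ b ℤ.* b ℤ.+ 1ℤ) ℤ.* (z ℤ.* z ℤ.+ w ℤ.* w)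
    identity = solve-∀
    vanish : ∀ x c → x ℤ.+ (ℤ.- 1ℤ ℤ.+ 1ℤ) ℤ.* c ≡ x
    vanish = solve-∀

  -- The map (z, w) ↦ (az + bw, bz - aw) is invertible: its Schur complement Δ = -a - ba⁻¹b
  -- satisfies Δ·a = -(a² + b²) - b²(aa⁻¹ - 1) ≡ 1.
  rotation-complement-unit : ∀ {n} a a⁻¹ b → a ℤ.* a⁻¹ ≡[ n ] 1ℤ → a ℤ.* a ℤ.+ b ℤ.* b ≡[ n ] ℤ.- 1ℤ →
    (ℤ.- a ℤ.- b ℤ.* a⁻¹ ℤ.* b) ℤ.* a ≡[ n ] 1ℤ
  rotation-complement-unit {n} a a⁻¹ b aa⁻¹≡1 a²+b²≡-1 = ≡[]-trans {n} (≡⇒≡[] (expand a a⁻¹ b))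
    (≡[]-trans {n} (≡[]-+ {n} (≡[]-neg {n} a²+b²≡-1)
                              (≡[]-neg {n} (≡[]-* {n} (≡[]-refl (b ℤ.* b)) (≡[]-+ {n} aa⁻¹≡1 (≡[]-refl (ℤ.- 1ℤ))))))
                   (≡⇒≡[] (simplify (b ℤ.* b))))
    where
    expand : ∀ a a⁻¹ b → (ℤ.- a ℤ.- b ℤ.* a⁻¹ ℤ.* b) ℤ.* a
                         ≡ ℤ.- (a ℤ.* a ℤ.+ b ℤ.* b) ℤ.+ ℤ.- (b ℤ.* b ℤ.* (a ℤ.* a⁻¹ ℤ.+ ℤ.- 1ℤ))
    expand = solve-∀
    simplify : ∀ c → ℤ.- (ℤ.- 1ℤ) ℤ.+ ℤ.- (c ℤ.* (1ℤ ℤ.+ ℤ.- 1ℤ)) ≡ 1ℤ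
    simplify = solve-∀

  module AtOddPrime (p q : ℕ) (pp : Prime p) (p≡2q+1 : p ≡ suc (2 ℕ.* q)) where

    private
      instance
        p≢0 : NonZero p
        p≢0 = prime⇒nonZero pp

    Hyp : (ℤ → ℕ) → ℤ → ℕ
    Hyp G s = ∑ p (λ u → ∑ p (λ v → G (s ℤ.+ + u ℤ.* + v)))

    -- u = 0 contributes p·G(s); for each of the p - 1 units u, v ↦ s + uv runs over ℤ/pℤ.
    Hyp-eval : ∀ G → Periodic p G → ∀ s → Hyp G s ≡ p ℕ.* G s ℕ.+ (p ∸ 1) ℕ.* ∑mod p G
    Hyp-eval G per s = begin
        Hyp G s
      ≡⟨ cong (λ m → ∑ m (λ u → ∑ p (λ v → G (s ℤ.+ + u ℤ.* + v)))) (pred-suc p) ⟩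
        ∑ p (λ v → G (s ℤ.+ 0ℤ ℤ.* + v)) ℕ.+ ∑ (p ∸ 1) (λ u → ∑ p (λ v → G (s ℤ.+ + suc u ℤ.* + v)))
      ≡⟨ cong₂ ℕ._+_ (∑-cong p (λ v → cong G (zero-term s (+ v))))
           (∑-congᵇ (p ∸ 1) (λ u u<p∸1 → ∑mod-affine p G per (+ suc u) (unit u u<p∸1) s)) ⟩
        ∑ p (λ v → G s) ℕ.+ ∑ (p ∸ 1) (λ u → ∑mod p G)
      ≡⟨ cong₂ ℕ._+_ (∑-const p (G s)) (∑-const (p ∸ 1) (∑mod p G)) ⟩
        p ℕ.* G s ℕ.+ (p ∸ 1) ℕ.* ∑mod p G ∎
      where
      open ≡-Reasoning
      zero-term : ∀ s v → s ℤ.+ 0ℤ ℤ.* v ≡ s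
      zero-term = solve-∀
      unit : ∀ u → u < p ∸ 1 → Invertible p (+ suc u)
      unit u u<p∸1 = coprime⇒invertible (suc u) p (prime∤⇒coprime pp (λ p∣ →
        <⇒≱ (subst (suc u <_) (sym (pred-suc p)) (s≤s u<p∸1)) (∣⇒≤ p∣)))

    Hyp-periodic : ∀ G → Periodic p G → Periodic p (Hyp G)
    Hyp-periodic G per {a} {b} a≡b = trans (Hyp-eval G per a)
      (trans (cong (λ z → p ℕ.* z ℕ.+ (p ∸ 1) ℕ.* ∑mod p G) (per a≡b)) (sym (Hyp-eval G per b)))

    -2-unit : Invertible p (ℤ.- + 2)
    -2-unit = ℤ.- + suc q , 1ℤ , (begin
        ℤ.- + 2 ℤ.* ℤ.- + suc q                ≡⟨ cong (λ v → ℤ.- + 2 ℤ.* ℤ.- v) (ℤP.pos-+ 1 q) ⟩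
        ℤ.- + 2 ℤ.* ℤ.- (1ℤ ℤ.+ + q)          ≡⟨ expand (+ q) ⟩
        1ℤ ℤ.+ 1ℤ ℤ.* (1ℤ ℤ.+ + 2 ℤ.* + q)   ≡⟨ cong (λ v → 1ℤ ℤ.+ 1ℤ ℤ.* v) p≡ ⟨
        1ℤ ℤ.+ 1ℤ ℤ.* + p                       ∎)
      where
      open ≡-Reasoning
      expand : ∀ q → ℤ.- + 2 ℤ.* ℤ.- (1ℤ ℤ.+ q) ≡ 1ℤ ℤ.+ 1ℤ ℤ.* (1ℤ ℤ.+ + 2 ℤ.* q)
      expand = solve-∀
      p≡ : + p ≡ 1ℤ ℤ.+ + 2 ℤ.* + q
      p≡ = trans (cong +_ p≡2q+1) (trans (ℤP.pos-+ 1 (2 ℕ.* q)) (cong (λ v → 1ℤ ℤ.+ v) (ℤP.pos-* 2 q)))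

    -- x² - y² = (x + y)(x - y), and (x, y) ↦ (x + y, x - y) is invertible as p is odd:
    -- the form x² - y² is a hyperbolic plane.
    ∑-difference-of-squares : ∀ G → Periodic p G → ∀ s →
      ∑ p (λ x → ∑ p (λ y → G (s ℤ.+ + x ℤ.* + x ℤ.- + y ℤ.* + y))) ≡ Hyp G s
    ∑-difference-of-squares G per s = trans
      (∑-cong p (λ x → ∑-cong p (λ y → cong G (factor s (+ x) (+ y)))))
      (∑₂-linear p (λ u v → G (s ℤ.+ u ℤ.* v)) (λ e₁ e₂ → per (≡[]-+ {p} (≡[]-refl s) (≡[]-* {p} e₁ e₂)))
        1ℤ 1ℤ 1ℤ 1ℤ (ℤ.- 1ℤ) (≡[]-refl 1ℤ) -2-unit)
      where
      factor : ∀ s x y → s ℤ.+ x ℤ.* x ℤ.- y ℤ.* y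
                         ≡ s ℤ.+ (1ℤ ℤ.* x ℤ.+ 1ℤ ℤ.* y) ℤ.* (1ℤ ℤ.* x ℤ.+ ℤ.- 1ℤ ℤ.* y)
      factor = solve-∀

    -- Since -1 = a² + b², the map (z, w) ↦ (az + bw, bz - aw) turns z² + w² into -(z² + w²)
    -- modulo p: the form z² + w² is equivalent to its negative.
    ∑-sum-of-squares-negate : ∀ G → Periodic p G → ∀ s →
      ∑ p (λ z → ∑ p (λ w → G (s ℤ.+ + z ℤ.* + z ℤ.+ + w ℤ.* + w)))
        ≡ ∑ p (λ z → ∑ p (λ w → G (s ℤ.- + z ℤ.* + z ℤ.- + w ℤ.* + w)))
    ∑-sum-of-squares-negate G per s with minus-one-sum-of-two-squares p q pp p≡2q+1
    ... | a , b , (a⁻¹ , aa⁻¹≡1) , a²+b²≡-1 = trans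
      (∑-cong p (λ z → ∑-cong p (λ w → per (rotation-negates a b a²+b²≡-1 s (+ z) (+ w)))))
      (∑₂-linear p (λ u v → G (s ℤ.- u ℤ.* u ℤ.- v ℤ.* v))
        (λ e₁ e₂ → per (≡[]-+ {p} (≡[]-+ {p} (≡[]-refl s) (≡[]-neg {p} (≡[]-* {p} e₁ e₁)))
                                   (≡[]-neg {p} (≡[]-* {p} e₂ e₂))))
        a a⁻¹ b b (ℤ.- a) aa⁻¹≡1 (a , rotation-complement-unit a a⁻¹ b aa⁻¹≡1 a²+b²≡-1))

module OddPrimeCounts where

  open import Data.Nat as ℕ using (ℕ; zero; suc; _+_; _*_; _∸_; _^_; NonZero)
  open import Data.Nat.Properties using (*-suc; *-comm; *-identityʳ; ^-distribˡ-+-*; *-cancelˡ-≡; +-cancelʳ-≡; m^n≢0)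
  open import Data.Integer as ℤ using (ℤ; +_; 0ℤ)
  import Data.Integer.Properties as ℤP
  open import Relation.Binary.PropositionalEquality
  open import Data.Nat.Primality using (Prime; prime⇒nonZero)
  open import Data.Nat.Divisibility using (_∣0)
  open import Data.Integer.Tactic.RingSolver using () renaming (solve-∀ to solveℤ-∀)
  open import Data.Nat.Tactic.RingSolver using (solve-∀)
  open FiniteSums
  open Congruence
  open ResidueSums
  open SquareSums
  open Indicator
  open PrimeSums
  open HyperbolicPlane

  -- Four squares form two hyperbolic planes, giving N(l + 4) in terms of N(l).
  module _ (p q : ℕ) (pp : Prime p) (p≡2q+1 : p ≡ suc (2 * q)) where

    private
      instance
        p≢0 : NonZero p
        p≢0 = prime⇒nonZero pp

      r : ℕ
      r = p ∸ 1

      p≡1+r : p ≡ suc r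
      p≡1+r = pred-suc p

    open AtOddPrime p q pp p≡2q+1

    -- x² + y² + z² + w² ≡ (x² - z²) + (y² - w²) after negating z² + w².
    SqSum-4 : ∀ G → Periodic p G → ∀ s → SqSum p 4 G s ≡ Hyp (Hyp G) s
    SqSum-4 G per s = begin
        ∑ p (λ x → ∑ p (λ y → ∑ p (λ z → ∑ p (λ w →
          G (s ℤ.+ + x ℤ.* + x ℤ.+ + y ℤ.* + y ℤ.+ + z ℤ.* + z ℤ.+ + w ℤ.* + w)))))
      ≡⟨ ∑-cong p (λ x → ∑-cong p (λ y → ∑-sum-of-squares-negate G per (s ℤ.+ + x ℤ.* + x ℤ.+ + y ℤ.* + y))) ⟩
        ∑ p (λ x → ∑ p (λ y → ∑ p (λ z → ∑ p (λ w →
          G (s ℤ.+ + x ℤ.* + x ℤ.+ + y ℤ.* + y ℤ.- + z ℤ.* + z ℤ.- + w ℤ.* + w)))))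
      ≡⟨ ∑-cong p (λ x → ∑-swap p p _) ⟩
        ∑ p (λ x → ∑ p (λ z → ∑ p (λ y → ∑ p (λ w →
          G (s ℤ.+ + x ℤ.* + x ℤ.+ + y ℤ.* + y ℤ.- + z ℤ.* + z ℤ.- + w ℤ.* + w)))))
      ≡⟨ ∑-cong p (λ x → ∑-cong p (λ z → ∑-cong p (λ y → ∑-cong p (λ w →
           cong G (regroup s (+ x) (+ y) (+ z) (+ w)))))) ⟩
        ∑ p (λ x → ∑ p (λ z → ∑ p (λ y → ∑ p (λ w →
          G (s ℤ.+ + x ℤ.* + x ℤ.- + z ℤ.* + z ℤ.+ + y ℤ.* + y ℤ.- + w ℤ.* + w)))))
      ≡⟨ ∑-cong p (λ x → ∑-cong p (λ z → ∑-difference-of-squares G per (s ℤ.+ + x ℤ.* + x ℤ.- + z ℤ.* + z))) ⟩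
        ∑ p (λ x → ∑ p (λ z → Hyp G (s ℤ.+ + x ℤ.* + x ℤ.- + z ℤ.* + z)))
      ≡⟨ ∑-difference-of-squares (Hyp G) (Hyp-periodic G per) s ⟩
        Hyp (Hyp G) s ∎
      where
      open ≡-Reasoning
      regroup : ∀ s x y z w → s ℤ.+ x ℤ.* x ℤ.+ y ℤ.* y ℤ.- z ℤ.* z ℤ.- w ℤ.* w
                              ≡ s ℤ.+ x ℤ.* x ℤ.- z ℤ.* z ℤ.+ y ℤ.* y ℤ.- w ℤ.* w
      regroup = solveℤ-∀

    -- x² + y² + z² ≡ -z² + (x² - y²) after negating y² + z².
    SqSum-3 : ∀ G → Periodic p G → ∀ s → SqSum p 3 G s ≡ ∑ p (λ z → Hyp G (s ℤ.- + z ℤ.* + z))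
    SqSum-3 G per s = begin
        ∑ p (λ x → ∑ p (λ y → ∑ p (λ z → G (s ℤ.+ + x ℤ.* + x ℤ.+ + y ℤ.* + y ℤ.+ + z ℤ.* + z))))
      ≡⟨ ∑-cong p (λ x → ∑-sum-of-squares-negate G per (s ℤ.+ + x ℤ.* + x)) ⟩
        ∑ p (λ x → ∑ p (λ y → ∑ p (λ z → G (s ℤ.+ + x ℤ.* + x ℤ.- + y ℤ.* + y ℤ.- + z ℤ.* + z))))
      ≡⟨ ∑-cong p (λ x → ∑-swap p p _) ⟩
        ∑ p (λ x → ∑ p (λ z → ∑ p (λ y → G (s ℤ.+ + x ℤ.* + x ℤ.- + y ℤ.* + y ℤ.- + z ℤ.* + z))))
      ≡⟨ ∑-swap p p _ ⟩
        ∑ p (λ z → ∑ p (λ x → ∑ p (λ y → G (s ℤ.+ + x ℤ.* + x ℤ.- + y ℤ.* + y ℤ.- + z ℤ.* + z))))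
      ≡⟨ ∑-cong p (λ z → ∑-cong p (λ x → ∑-cong p (λ y → cong G (regroup s (+ x) (+ y) (+ z))))) ⟩
        ∑ p (λ z → ∑ p (λ x → ∑ p (λ y → G (s ℤ.- + z ℤ.* + z ℤ.+ + x ℤ.* + x ℤ.- + y ℤ.* + y))))
      ≡⟨ ∑-cong p (λ z → ∑-difference-of-squares G per (s ℤ.- + z ℤ.* + z)) ⟩
        ∑ p (λ z → Hyp G (s ℤ.- + z ℤ.* + z)) ∎
      where
      open ≡-Reasoning
      regroup : ∀ s x y z → s ℤ.+ x ℤ.* x ℤ.- y ℤ.* y ℤ.- z ℤ.* z ≡ s ℤ.- z ℤ.* z ℤ.+ x ℤ.* x ℤ.- y ℤ.* y
      regroup = solveℤ-∀

    ∑mod-Hyp : ∀ G → Periodic p G → ∑mod p (Hyp G) ≡ p * ∑mod p G + p * (r * ∑mod p G)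
    ∑mod-Hyp G per = trans (∑-cong p (λ c → Hyp-eval G per (+ c)))
      (trans (∑-+ p _ _) (cong₂ _+_ (∑-* p p _) (∑-const p _)))

    N : ℕ → ℕ
    N l = SqSum p l (χ p) 0ℤ

    private
      F : ℕ → ℤ → ℕ
      F l = SqSum p l (χ p)

      F-periodic : ∀ l → Periodic p (F l)
      F-periodic l = SqSum-periodic p p l (χ p) (χ-periodic p)

      ∑mod-F : ∀ l → ∑mod p (F l) ≡ p ^ l * r
      ∑mod-F l = trans (∑mod-SqSum p l (χ p) (χ-periodic p)) (cong (p ^ l *_) (∑mod-χ-prime p pp))

    -- Adding four squares: N(l + 4) = Hyp(Hyp F_l)(0) with F_l = SqSum p l (χ p), and each
    -- hyperbolic plane is evaluated by Hyp-eval, using Σ F_l = pˡ(p - 1).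
    N-step : ∀ l → N (4 + l) ≡ p * (p * N l + r * (p ^ l * r))
                               + r * (p * (p ^ l * r) + p * (r * (p ^ l * r)))
    N-step l = begin
        N (4 + l)
      ≡⟨ SqSum-+ p 4 l (χ p) 0ℤ ⟩
        SqSum p 4 (F l) 0ℤ
      ≡⟨ SqSum-4 (F l) (F-periodic l) 0ℤ ⟩
        Hyp (Hyp (F l)) 0ℤ
      ≡⟨ Hyp-eval _ (Hyp-periodic _ (F-periodic l)) 0ℤ ⟩
        p * Hyp (F l) 0ℤ + r * ∑mod p (Hyp (F l))
      ≡⟨ cong₂ (λ u v → p * u + r * v) (Hyp-eval _ (F-periodic l) 0ℤ)
                                       (∑mod-Hyp (F l) (F-periodic l)) ⟩
        p * (p * N l + r * ∑mod p (F l)) + r * (p * ∑mod p (F l) + p * (r * ∑mod p (F l)))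
      ≡⟨ cong (λ t → p * (p * N l + r * t) + r * (p * t + p * (r * t))) (∑mod-F l) ⟩
        p * (p * N l + r * (p ^ l * r)) + r * (p * (p ^ l * r) + p * (r * (p ^ l * r))) ∎
      where open ≡-Reasoning

    private
      even-step-algebra : ∀ p r → p ≡ suc r → ∀ f X → p * f + r * X ≡ r * (X * X) →
        p * (p * (p * f + r * (X * X * r)) + r * (p * (X * X * r) + p * (r * (X * X * r))))
          + r * (p * (p * X)) ≡ r * (p * (p * (p * (p * (X * X)))))
      even-step-algebra .(suc r) r refl f X hyp = trans (expand r f X)
        (trans (cong (λ z → (1 + r) * (1 + r) * z + (1 + r) * (1 + r) * r * r * (X * X) * (2 + r)) hyp)
               (collect r X))
        where
        expand : ∀ r f X → (1 + r) * ((1 + r) * ((1 + r) * f + r * (X * X * r))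
            + r * ((1 + r) * (X * X * r) + (1 + r) * (r * (X * X * r)))) + r * ((1 + r) * ((1 + r) * X))
          ≡ (1 + r) * (1 + r) * ((1 + r) * f + r * X) + (1 + r) * (1 + r) * r * r * (X * X) * (2 + r)
        expand = solve-∀
        collect : ∀ r X → (1 + r) * (1 + r) * (r * (X * X)) + (1 + r) * (1 + r) * r * r * (X * X) * (2 + r)
                          ≡ r * ((1 + r) * ((1 + r) * ((1 + r) * ((1 + r) * (X * X)))))
        collect = solve-∀

      odd-step-algebra : ∀ p r → p ≡ suc r → ∀ f Z → p * f ≡ r * Z →
        p * (p * (p * f + r * (Z * r)) + r * (p * (Z * r) + p * (r * (Z * r))))
          ≡ r * (p * (p * (p * (p * Z))))
      odd-step-algebra .(suc r) r refl f Z hyp = trans (expand r f Z)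
        (trans (cong (λ z → (1 + r) * (1 + r) * z + (1 + r) * (1 + r) * r * r * Z * (2 + r)) hyp)
               (collect r Z))
        where
        expand : ∀ r f Z → (1 + r) * ((1 + r) * ((1 + r) * f + r * (Z * r))
            + r * ((1 + r) * (Z * r) + (1 + r) * (r * (Z * r))))
          ≡ (1 + r) * (1 + r) * ((1 + r) * f) + (1 + r) * (1 + r) * r * r * Z * (2 + r)
        expand = solve-∀
        collect : ∀ r Z → (1 + r) * (1 + r) * (r * Z) + (1 + r) * (1 + r) * r * r * Z * (2 + r)
                          ≡ r * ((1 + r) * ((1 + r) * ((1 + r) * ((1 + r) * Z))))
        collect = solve-∀

    N-multiple-of-4 : ∀ j → p * N (4 * j) + r * p ^ (2 * j) ≡ r * p ^ (4 * j)
    N-multiple-of-4 zero = trans (cong (λ z → p * z + r * 1) (χℕ-prime-∣ pp 0 (p ∣0)))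
                                 (cong (_+ r * 1) (*-comm p 0))
    N-multiple-of-4 (suc j) = begin
        p * N (4 * suc j) + r * p ^ (2 * suc j)
      ≡⟨ cong₂ (λ u v → p * N u + r * p ^ v) (*-suc 4 j) (*-suc 2 j) ⟩
        p * N (4 + 4 * j) + r * (p * (p * X))
      ≡⟨ cong (λ u → p * u + r * (p * (p * X))) (N-step (4 * j)) ⟩
        p * (p * (p * N (4 * j) + r * (p ^ (4 * j) * r)) + r * (p * (p ^ (4 * j) * r)
          + p * (r * (p ^ (4 * j) * r)))) + r * (p * (p * X))
      ≡⟨ cong (λ Y → p * (p * (p * N (4 * j) + r * (Y * r)) + r * (p * (Y * r) + p * (r * (Y * r))))
                     + r * (p * (p * X))) p⁴ʲ≡X² ⟩
        p * (p * (p * N (4 * j) + r * (X * X * r)) + r * (p * (X * X * r) + p * (r * (X * X * r))))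
          + r * (p * (p * X))
      ≡⟨ even-step-algebra p r p≡1+r (N (4 * j)) X (trans (N-multiple-of-4 j) (cong (r *_) p⁴ʲ≡X²)) ⟩
        r * (p * (p * (p * (p * (X * X)))))
      ≡⟨ cong (λ Y → r * (p * (p * (p * (p * Y))))) p⁴ʲ≡X² ⟨
        r * (p * (p * (p * (p * p ^ (4 * j)))))
      ≡⟨ cong (λ u → r * p ^ u) (*-suc 4 j) ⟨
        r * p ^ (4 * suc j) ∎
      where
      open ≡-Reasoning
      X : ℕ
      X = p ^ (2 * j)
      p⁴ʲ≡X² : p ^ (4 * j) ≡ X * X
      p⁴ʲ≡X² = trans (cong (p ^_) (double j)) (^-distribˡ-+-* p (2 * j) (2 * j))
        where
        double : ∀ j → 4 * j ≡ 2 * j + 2 * j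
        double = solve-∀

    N-1 : N 1 ≡ r
    N-1 = trans (∑-cong p (λ x → cong (χ p) (ℤP.+-identityˡ (+ x ℤ.* + x)))) (∑-χ-square p pp)

    -- Three squares: x² + y² + z² ~ -z² + (hyperbolic plane).
    N-3 : p * N 3 ≡ r * p ^ 3
    N-3 = begin
        p * N 3
      ≡⟨ cong (p *_) (SqSum-3 (χ p) (χ-periodic p) 0ℤ) ⟩
        p * ∑ p (λ z → Hyp (χ p) (0ℤ ℤ.- + z ℤ.* + z))
      ≡⟨ cong (p *_) (∑-cong p (λ z → Hyp-eval (χ p) (χ-periodic p) (0ℤ ℤ.- + z ℤ.* + z))) ⟩
        p * ∑ p (λ z → p * χ p (0ℤ ℤ.- + z ℤ.* + z) + r * ∑mod p (χ p))
      ≡⟨ cong (p *_) (trans (∑-+ p _ _) (cong₂ _+_ (∑-* p p _) (∑-const p _))) ⟩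
        p * (p * ∑ p (λ z → χ p (0ℤ ℤ.- + z ℤ.* + z)) + p * (r * ∑mod p (χ p)))
      ≡⟨ cong₂ (λ u v → p * (p * u + p * (r * v)))
           (trans (∑-cong p (λ z → cong (χ p) (ℤP.+-identityˡ (ℤ.- (+ z ℤ.* + z))))) (∑-χ-neg-square p pp))
           (∑mod-χ-prime p pp) ⟩
        p * (p * r + p * (r * r))
      ≡⟨ evaluate p r p≡1+r ⟩
        r * p ^ 3 ∎
      where
      open ≡-Reasoning
      evaluate : ∀ p r → p ≡ suc r → p * (p * r + p * (r * r)) ≡ r * p ^ 3
      evaluate .(suc r) r refl = identity r
        where
        identity : ∀ r → (1 + r) * ((1 + r) * r + (1 + r) * (r * r)) ≡ r * ((1 + r) * ((1 + r) * ((1 + r) * 1)))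
        identity = solve-∀

    -- Odd dimensions: p·N(2i + 1) = (p - 1)p²ⁱ⁺¹, from N(1), N(3) and steps of four.
    N-odd : ∀ i → p * N (suc (2 * i)) ≡ r * p ^ suc (2 * i)
    N-odd zero          = trans (cong (p *_) N-1) (trans (*-comm p r) (cong (r *_) (sym (*-identityʳ p))))
    N-odd (suc zero)    = N-3
    N-odd (suc (suc i)) = subst (λ m → p * N m ≡ r * p ^ m) (index i)
      (trans (cong (p *_) (N-step (suc (2 * i)))) (odd-step-algebra p r p≡1+r _ (p ^ suc (2 * i)) (N-odd i)))
      where
      index : ∀ i → 4 + suc (2 * i) ≡ suc (2 * suc (suc i))
      index = solve-∀

    N-odd-closed : ∀ i → N (suc (2 * i)) ≡ r * p ^ (2 * i)
    N-odd-closed i = *-cancelˡ-≡ (N (suc (2 * i))) _ p (trans (N-odd i) (swap r p (p ^ (2 * i))))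
      where
      swap : ∀ r p X → r * (p * X) ≡ p * (r * X)
      swap = solve-∀

    N-multiple-of-4-closed : ∀ j → N (4 * suc j) ≡ r * p ^ suc (2 * j) * (p ^ (2 * suc j) ∸ 1)
    N-multiple-of-4-closed j = *-cancelˡ-≡ (N (4 * suc j)) _ p (+-cancelʳ-≡ (r * W) _ _ (begin
        p * N (4 * suc j) + r * W
      ≡⟨ cong (λ e → p * N (4 * suc j) + r * p ^ e) (*-suc 2 j) ⟨
        p * N (4 * suc j) + r * p ^ (2 * suc j)
      ≡⟨ N-multiple-of-4 (suc j) ⟩
        r * p ^ (4 * suc j)
      ≡⟨ cong (r *_) p⁴⁽ʲ⁺¹⁾≡W² ⟩
        r * (W * W)
      ≡⟨ cong (λ v → r * (W * v)) W≡1+Z ⟩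
        r * (W * suc Z)
      ≡⟨ rearrange r p Y Z ⟩
        p * (r * Y * Z) + r * W
      ≡⟨ cong (λ v → p * (r * Y * v) + r * W) (cong (_∸ 1) (cong (p ^_) (*-suc 2 j))) ⟨
        p * (r * Y * (p ^ (2 * suc j) ∸ 1)) + r * W ∎))
      where
      open ≡-Reasoning
      Y : ℕ
      Y = p ^ suc (2 * j)
      W : ℕ
      W = p * Y
      Z : ℕ
      Z = W ∸ 1
      W≡1+Z : W ≡ suc Z
      W≡1+Z = pred-suc W {{m^n≢0 p (suc (suc (2 * j)))}}
      p⁴⁽ʲ⁺¹⁾≡W² : p ^ (4 * suc j) ≡ W * W
      p⁴⁽ʲ⁺¹⁾≡W² = trans (cong (p ^_) (double j)) (^-distribˡ-+-* p (suc (suc (2 * j))) _)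
        where
        double : ∀ j → 4 * suc j ≡ suc (suc (2 * j)) + suc (suc (2 * j))
        double = solve-∀
      rearrange : ∀ r p Y Z → r * (p * Y * suc Z) ≡ p * (r * Y * Z) + r * (p * Y)
      rearrange = solve-∀

module ArithmeticFunctions where

  open import Data.Nat as ℕ using (zero; suc; _*_; _∸_; _^_; _<_; NonZero; >-nonZero)
  open import Data.Nat.Properties using (+-identityʳ; *-comm)
  open import Data.Integer as ℤ using (+_; 0ℤ)
  open import Relation.Binary.PropositionalEquality
  open import Data.Nat.Primality using (Prime)
  open import Data.Nat.Coprimality as C using (Coprime)
  open import Defs using (Φ; φ)
  open FiniteSums
  open ResidueSums
  open SquareSums
  open Indicator
  open PrimeSums using (∑mod-χ-prime)

  Φ-* : ∀ k A B → 0 < A → Coprime A B → Φ k (A * B) ≡ Φ k A * Φ k B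
  Φ-* k A B 0<A cop = begin
      Φ k (A * B)
    ≡⟨ Φ≡SqSum k (A * B) ⟩
      SqSum (A * B) k (χ (A * B)) 0ℤ
    ≡⟨ SqSum-cong (A * B) k (χ-* A B) 0ℤ ⟩
      SqSum (A * B) k (λ z → χ A z * χ B z) 0ℤ
    ≡⟨ SqSum-crt A B (C.sym cop) (χ A) (χ B) (χ-periodic A) (χ-periodic B) k 0ℤ ⟩
      SqSum A k (χ A) 0ℤ * SqSum B k (χ B) 0ℤ
    ≡⟨ cong₂ _*_ (Φ≡SqSum k A) (Φ≡SqSum k B) ⟨
      Φ k A * Φ k B ∎
    where
    open ≡-Reasoning
    instance
      A≢0 : NonZero A
      A≢0 = >-nonZero 0<A

  φ-* : ∀ A B → 0 < A → Coprime A B → φ (A * B) ≡ φ A * φ B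
  φ-* A B 0<A cop = begin
      φ (A * B)                                ≡⟨ φ≡∑mod (A * B) ⟩
      ∑mod (A * B) (χ (A * B))                 ≡⟨ ∑-cong (A * B) (λ x → χ-* A B (+ x)) ⟩
      ∑ (A * B) (λ x → χ A (+ x) * χ B (+ x))  ≡⟨ ∑mod-crt A B (C.sym cop) (χ A) (χ B) (χ-periodic A) (χ-periodic B) ⟩
      ∑mod A (χ A) * ∑mod B (χ B)              ≡⟨ cong₂ _*_ (φ≡∑mod A) (φ≡∑mod B) ⟨
      φ A * φ B                                ∎
    where
    open ≡-Reasoning
    instance
      A≢0 : NonZero A
      A≢0 = >-nonZero 0<A

  -- At a prime power pᵉ⁺¹ everything is lifted from ℤ/pℤ, each variable contributing pᵉ.
  Φ-^ : ∀ k p e → Φ k (p ^ suc e) ≡ (p ^ e) ^ k * SqSum p k (χ p) 0ℤ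
  Φ-^ k p e = begin
      Φ k (p ^ suc e)                     ≡⟨ Φ≡SqSum k (p ^ suc e) ⟩
      SqSum (p ^ suc e) k (χ (p ^ suc e)) 0ℤ ≡⟨ SqSum-cong _ k (χ-^ p e) 0ℤ ⟩
      SqSum (p ^ suc e) k (χ p) 0ℤ        ≡⟨ cong (λ n → SqSum n k (χ p) 0ℤ) (*-comm p (p ^ e)) ⟩
      SqSum (p ^ e * p) k (χ p) 0ℤ        ≡⟨ SqSum-periods (p ^ e) p (χ p) (χ-periodic p) k 0ℤ ⟩
      (p ^ e) ^ k * SqSum p k (χ p) 0ℤ    ∎
    where open ≡-Reasoning

  φ-prime^ : ∀ p e → Prime p → φ (p ^ suc e) ≡ p ^ e * (p ∸ 1)
  φ-prime^ p e p-prime = begin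
      φ (p ^ suc e)                ≡⟨ φ≡∑mod (p ^ suc e) ⟩
      ∑mod (p ^ suc e) (χ (p ^ suc e)) ≡⟨ ∑-cong (p ^ suc e) (λ x → χ-^ p e (+ x)) ⟩
      ∑mod (p ^ suc e) (χ p)       ≡⟨ cong (λ n → ∑mod n (χ p)) (*-comm p (p ^ e)) ⟩
      ∑mod (p ^ e * p) (χ p)       ≡⟨ ∑mod-periods (p ^ e) p (χ p) (χ-periodic p) ⟩
      p ^ e * ∑mod p (χ p)         ≡⟨ cong (p ^ e *_) (∑mod-χ-prime p p-prime) ⟩
      p ^ e * (p ∸ 1)              ∎
    where open ≡-Reasoning

  Φ-1 : ∀ k → Φ k 1 ≡ 1
  Φ-1 k = trans (Φ≡SqSum k 1) (all-units k 0ℤ)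
    where
    all-units : ∀ k s → SqSum 1 k (χ 1) s ≡ 1
    all-units zero    s = χ-1 s
    all-units (suc k) s = trans (+-identityʳ _) (all-units k _)

module Factorisation where

  open import Data.Nat as ℕ using (ℕ; zero; suc; _*_; _^_; _<_; _≤_; z≤n; s≤s; >-nonZero; z<s)
  open import Data.Nat.Properties
  open import Data.Nat.Base using (nonTrivial⇒n>1)
  open import Data.Product using (Σ; _,_; _×_)
  open import Data.Empty using (⊥-elim)
  open import Data.List using ([]; _∷_)
  open import Data.List.Relation.Unary.All using (_∷_)
  open import Relation.Binary.PropositionalEquality
  open import Relation.Nullary using (yes; no; ¬_)
  open import Data.Nat.Primality using (Prime; prime⇒nonZero; prime⇒nonTrivial)
  open import Data.Nat.Primality.Factorisation using (factorise)
  open import Data.Nat.Divisibility using (_∣_; divides; _∣?_)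
  open import Data.Nat.Coprimality as C using (Coprime)
  open import Data.Nat.Induction using (<-rec)
  open import Data.Nat.ListAction using (product)
  open Indicator using (prime∤⇒coprime; coprime-^)

  prime>1 : ∀ {p} → Prime p → 1 < p
  prime>1 {p} pp = nonTrivial⇒n>1 p {{prime⇒nonTrivial pp}}

  prime^-pos : ∀ {p} → Prime p → ∀ e → 0 < p ^ e
  prime^-pos {p} pp e = m^n>0 p {{prime⇒nonZero pp}} e

  prime-divisor : ∀ n → 1 < n → Σ ℕ λ p → Prime p × p ∣ n
  prime-divisor n 1<n with factorise n {{>-nonZero (<-trans z<s 1<n)}}
  ... | record { factors = [] ; isFactorisation = e } = ⊥-elim (<-irrefl (sym e) 1<n)
  ... | record { factors = f ∷ fs ; isFactorisation = e ; factorsPrime = f-prime ∷ _ } =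
    f , f-prime , divides (product fs) (trans e (*-comm f _))

  private
    factor-pos : ∀ q m n → n ≡ q * m → 0 < n → 0 < q
    factor-pos zero    m n eq 0<n = ⊥-elim (<-irrefl (sym eq) 0<n)
    factor-pos (suc q) m n eq 0<n = s≤s z≤n

  prime-power-split : ∀ {p} → Prime p → ∀ n → 0 < n → p ∣ n →
                      Σ ℕ λ e → Σ ℕ λ m → n ≡ p ^ suc e * m × ¬ p ∣ m × 0 < m
  prime-power-split {p} pp = <-rec _ split
    where
    split : ∀ n → (∀ {y} → y < n → 0 < y → p ∣ y → Σ ℕ λ e → Σ ℕ λ m → y ≡ p ^ suc e * m × ¬ p ∣ m × 0 < m) →
            0 < n → p ∣ n → Σ ℕ λ e → Σ ℕ λ m → n ≡ p ^ suc e * m × ¬ p ∣ m × 0 < m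
    split n rec 0<n (divides q n≡qp) with p ∣? q
    ... | no p∤q = 0 , q , trans n≡qp (trans (*-comm q p) (cong (_* q) (sym (*-identityʳ p)))) , p∤q ,
                   factor-pos q p n n≡qp 0<n
    ... | yes p∣q with rec q<n (factor-pos q p n n≡qp 0<n) p∣q
      where
      q<n : q < n
      q<n = subst (q <_) (sym n≡qp) (m<m*n q p {{>-nonZero (factor-pos q p n n≡qp 0<n)}} (prime>1 pp))
    ...   | e , m , q≡ , p∤m , 0<m = suc e , m , trans n≡qp (trans (cong (_* p) q≡) (rotate (p ^ suc e) m)) , p∤m , 0<m
      where
      rotate : ∀ a m → a * m * p ≡ p * a * m
      rotate a m = trans (*-comm (a * m) p) (sym (*-assoc p a m))

  multiplicative-induction : (P : ℕ → Set) → P 1 →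
    (∀ p e m → Prime p → ¬ p ∣ m → 0 < m → P m → P (p ^ suc e * m)) → ∀ n → 0 < n → P n
  multiplicative-induction P base step = <-rec _ go
    where
    go : ∀ n → (∀ {y} → y < n → 0 < y → P y) → 0 < n → P n
    go (suc zero) rec _ = base
    go (suc (suc n)) rec _ with prime-divisor (suc (suc n)) (s≤s (s≤s z≤n))
    ... | p , pp , p∣n with prime-power-split pp (suc (suc n)) (s≤s z≤n) p∣n
    ...   | e , m , n≡ , p∤m , 0<m = subst P (sym n≡) (step p e m pp p∤m 0<m (rec m<n 0<m))
      where
      pᵉ⁺¹>1 : 1 < p ^ suc e
      pᵉ⁺¹>1 = <-≤-trans (prime>1 pp) (subst (_≤ p ^ suc e) (*-identityʳ p) (*-monoʳ-≤ p (prime^-pos pp e)))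
      m<n : m < suc (suc n)
      m<n = subst (m <_) (trans (*-comm m _) (sym n≡)) (m<m*n m (p ^ suc e) {{>-nonZero 0<m}} pᵉ⁺¹>1)

  multiplicative-agree : ∀ {A : Set} (_·_ : A → A → A) (f g : ℕ → A) →
    (∀ a b → 0 < a → 0 < b → Coprime a b → f (a * b) ≡ f a · f b) →
    (∀ a b → 0 < a → 0 < b → Coprime a b → g (a * b) ≡ g a · g b) →
    f 1 ≡ g 1 → (∀ p e → Prime p → f (p ^ suc e) ≡ g (p ^ suc e)) →
    ∀ n → 0 < n → f n ≡ g n
  multiplicative-agree _·_ f g f-mult g-mult f1≡g1 local =
    multiplicative-induction (λ n → f n ≡ g n) f1≡g1 step
    where
    step : ∀ p e m → Prime p → ¬ p ∣ m → 0 < m → f m ≡ g m → f (p ^ suc e * m) ≡ g (p ^ suc e * m)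
    step p e m pp p∤m 0<m fm≡gm = begin
        f (p ^ suc e * m)
      ≡⟨ f-mult _ m (prime^-pos pp (suc e)) 0<m coprime ⟩
        f (p ^ suc e) · f m
      ≡⟨ cong₂ _·_ (local p e pp) fm≡gm ⟩
        g (p ^ suc e) · g m
      ≡⟨ g-mult _ m (prime^-pos pp (suc e)) 0<m coprime ⟨
        g (p ^ suc e * m) ∎
      where
      open ≡-Reasoning
      coprime : Coprime (p ^ suc e) m
      coprime = C.sym (coprime-^ (prime∤⇒coprime pp p∤m) (suc e))

module Rationals where

  open import Data.Nat as ℕ using (suc; _∸_; _<_; z≤n; s≤s)
  open import Data.Integer as ℤ using (+_)
  import Data.Integer.Properties as ℤP
  open import Data.Rational as ℚ using (_+_; _*_; _-_; 0ℚ; 1ℚ; mkℚ; 1/_; _÷_; ≢-nonZero)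
  import Data.Rational.Properties as ℚP
  open import Relation.Binary.PropositionalEquality
  open import Relation.Nullary using (yes; no)
  open import Data.Empty using (⊥-elim)
  open import Data.Maybe using (Maybe; just; nothing)
  open import Tactic.RingSolver.Core.AlmostCommutativeRing using (AlmostCommutativeRing; fromCommutativeRing)
  import Data.Nat.Coprimality as C
  open import Data.Integer.Tactic.RingSolver using () renaming (solve-∀ to solveℤ-∀)
  open import Tactic.RingSolver using (solve-∀)
  open import Defs using (fromℕ; _⊘_)

  ringℚ : AlmostCommutativeRing _ _
  ringℚ = fromCommutativeRing ℚP.+-*-commutativeRing is-zero
    where
    is-zero : ∀ x → Maybe (0ℚ ≡ x)
    is-zero x with 0ℚ ℚP.≟ x
    ... | yes e = just e
    ... | no _  = nothing

  fromℕ-mkℚ : ∀ n → fromℕ n ≡ mkℚ (+ n) 0 (C.recompute (C.sym (C.1-coprimeTo n)))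
  fromℕ-mkℚ n = ℚP.normalize-coprime (C.recompute (C.sym (C.1-coprimeTo n)))

  fromℕ-* : ∀ m n → fromℕ (m ℕ.* n) ≡ fromℕ m * fromℕ n
  fromℕ-* m n = sym (trans (cong₂ _*_ (fromℕ-mkℚ m) (fromℕ-mkℚ n)) (cong (ℚ._/ 1) (sym (ℤP.pos-* m n))))

  fromℕ-+ : ∀ m n → fromℕ (m ℕ.+ n) ≡ fromℕ m + fromℕ n
  fromℕ-+ m n = sym (trans (cong₂ _+_ (fromℕ-mkℚ m) (fromℕ-mkℚ n))
    (cong (ℚ._/ 1) (trans (unit-denominators (+ m) (+ n)) (sym (ℤP.pos-+ m n)))))
    where
    unit-denominators : ∀ a b → a ℤ.* ℤ.+ 1 ℤ.+ b ℤ.* ℤ.+ 1 ≡ a ℤ.+ b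
    unit-denominators = solveℤ-∀

  fromℕ≢0 : ∀ n → 0 < n → fromℕ n ≢ 0ℚ
  fromℕ≢0 (suc n) _ e with trans (sym (fromℕ-mkℚ (suc n))) e
  ... | ()

  ⊘≡÷ : ∀ x q (q≢0 : q ≢ 0ℚ) → x ⊘ q ≡ _÷_ x q {{≢-nonZero q≢0}}
  ⊘≡÷ x q q≢0 with q ℚP.≟ 0ℚ
  ... | yes q≡0 = ⊥-elim (q≢0 q≡0)
  ... | no _    = refl

  ⊘-cancel : ∀ x d → d ≢ 0ℚ → (x * d) ⊘ d ≡ x
  ⊘-cancel x d d≢0 = trans (⊘≡÷ (x * d) d d≢0)
    (trans (ℚP.*-assoc x d _) (trans (cong (x *_) (ℚP.*-inverseʳ d {{≢-nonZero d≢0}})) (ℚP.*-identityʳ x)))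

  ⊘-self : ∀ d → d ≢ 0ℚ → d ⊘ d ≡ 1ℚ
  ⊘-self d d≢0 = trans (cong (_⊘ d) (sym (ℚP.*-identityˡ d))) (⊘-cancel 1ℚ d d≢0)

  fromℕ-*-⊘ : ∀ m d x → 0 < d → fromℕ (m ℕ.* d) * (x ⊘ fromℕ d) ≡ fromℕ m * x
  fromℕ-*-⊘ m d x 0<d = begin
      fromℕ (m ℕ.* d) * (x ⊘ fromℕ d)
    ≡⟨ cong₂ _*_ (fromℕ-* m d) (⊘≡÷ x (fromℕ d) d≢0) ⟩
      fromℕ m * fromℕ d * (x * 1/ fromℕ d)
    ≡⟨ regroup (fromℕ m) (fromℕ d) x (1/ fromℕ d) ⟩
      fromℕ m * (x * (fromℕ d * 1/ fromℕ d))
    ≡⟨ cong (λ z → fromℕ m * (x * z)) (ℚP.*-inverseʳ (fromℕ d)) ⟩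
      fromℕ m * (x * 1ℚ)
    ≡⟨ cong (fromℕ m *_) (ℚP.*-identityʳ x) ⟩
      fromℕ m * x ∎
    where
    open ≡-Reasoning
    d≢0 : fromℕ d ≢ 0ℚ
    d≢0 = fromℕ≢0 d 0<d
    instance
      d⁻¹ : ℚ.NonZero (fromℕ d)
      d⁻¹ = ≢-nonZero d≢0
    regroup : ∀ m d x i → m * d * (x * i) ≡ m * (x * (d * i))
    regroup = solve-∀ ringℚ

  Euler-factor : ∀ N M → 0 < N → fromℕ (N ℕ.* M) * (1ℚ - 1ℚ ⊘ fromℕ N) ≡ fromℕ (M ℕ.* (N ∸ 1))
  Euler-factor (suc N′) M _ = begin
      fromℕ (suc N′ ℕ.* M) * (1ℚ - 1ℚ ⊘ fromℕ (suc N′))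
    ≡⟨ cong₂ (λ u v → u * (1ℚ - v)) (trans (fromℕ-* (suc N′) M) (cong (_* fromℕ M) (fromℕ-+ 1 N′)))
                                     (⊘≡÷ 1ℚ (fromℕ (suc N′)) N≢0) ⟩
      (1ℚ + fromℕ N′) * fromℕ M * (1ℚ - 1ℚ * 1/ fromℕ (suc N′))
    ≡⟨ distribute (fromℕ N′) (fromℕ M) (1/ fromℕ (suc N′)) ⟩
      fromℕ M * ((1ℚ + fromℕ N′) - (1ℚ + fromℕ N′) * 1/ fromℕ (suc N′))
    ≡⟨ cong (λ z → fromℕ M * ((1ℚ + fromℕ N′) - z)) N·N⁻¹≡1 ⟩
      fromℕ M * ((1ℚ + fromℕ N′) - 1ℚ)
    ≡⟨ simplify (fromℕ N′) (fromℕ M) ⟩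
      fromℕ M * fromℕ N′
    ≡⟨ fromℕ-* M N′ ⟨
      fromℕ (M ℕ.* N′) ∎
    where
    open ≡-Reasoning
    N≢0 : fromℕ (suc N′) ≢ 0ℚ
    N≢0 = fromℕ≢0 (suc N′) (s≤s z≤n)
    instance
      N⁻¹ : ℚ.NonZero (fromℕ (suc N′))
      N⁻¹ = ≢-nonZero N≢0
    N·N⁻¹≡1 : (1ℚ + fromℕ N′) * 1/ fromℕ (suc N′) ≡ 1ℚ
    N·N⁻¹≡1 = trans (cong (_* 1/ fromℕ (suc N′)) (sym (fromℕ-+ 1 N′))) (ℚP.*-inverseʳ (fromℕ (suc N′)))
    distribute : ∀ n m i → (1ℚ + n) * m * (1ℚ - 1ℚ * i) ≡ m * ((1ℚ + n) - (1ℚ + n) * i)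
    distribute = solve-∀ ringℚ
    simplify : ∀ n m → m * ((1ℚ + n) - 1ℚ) ≡ m * n
    simplify = solve-∀ ringℚ

module Jordan where

  open import Data.Nat as ℕ using (ℕ; zero; suc; _∸_; _^_; _<_; _≤_; z≤n; s≤s)
  import Data.Nat.Properties as ℕP
  open import Data.Rational as ℚ using (ℚ; _*_; _-_; 1ℚ)
  import Data.Rational.Properties as ℚP
  open import Relation.Binary.PropositionalEquality hiding (J)
  open import Relation.Nullary using (yes; no; ¬_; Dec; does)
  open import Relation.Nullary.Decidable using (dec-true; dec-false; _×-dec_)
  open import Relation.Unary using (Pred; Decidable)
  open import Data.Empty using (⊥-elim)
  open import Data.Product using (_×_; _,_; proj₁; proj₂)
  open import Data.Sum using (inj₁; inj₂; [_,_]′)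
  open import Data.Bool using (if_then_else_; true; false)
  open import Data.List using ([]; _∷_; filter; foldr; applyUpTo; upTo)
  open import Data.Nat.Primality using (Prime; prime?; euclidsLemma; prime⇒irreducible; prime⇒nonTrivial; prime⇒nonZero)
  open import Data.Nat.Base using (nonTrivial⇒≢1)
  open import Data.Nat.Divisibility using (_∣_; _∣?_; ∣m⇒∣m*n; ∣n⇒∣m*n; ∣⇒≤; ∣1⇒≡1; ∣-refl)
  open import Data.Nat.Coprimality using (Coprime)
  open import Tactic.RingSolver using (solve-∀)
  open import Data.Nat.Tactic.RingSolver using () renaming (solve-∀ to solveℕ-∀)
  open import Defs using (fromℕ; _⊘_; J)
  open Rationals

  ∏ : ℕ → (ℕ → ℚ) → ℚ
  ∏ zero    g = 1ℚ
  ∏ (suc n) g = g 0 * ∏ n (λ x → g (suc x))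

  ∏-cong : ∀ n {f g : ℕ → ℚ} → (∀ x → f x ≡ g x) → ∏ n f ≡ ∏ n g
  ∏-cong zero    e = refl
  ∏-cong (suc n) e = cong₂ _*_ (e 0) (∏-cong n (λ x → e (suc x)))

  ∏-* : ∀ n f g → ∏ n (λ x → f x * g x) ≡ ∏ n f * ∏ n g
  ∏-* zero    f g = refl
  ∏-* (suc n) f g = trans (cong (f 0 * g 0 *_) (∏-* n _ _)) (interchange (f 0) (g 0) _ _)
    where
    interchange : ∀ a b c d → a * b * (c * d) ≡ a * c * (b * d)
    interchange = solve-∀ ringℚ

  ∏-snoc : ∀ n g → ∏ (suc n) g ≡ ∏ n g * g n
  ∏-snoc zero    g = trans (ℚP.*-identityʳ (g 0)) (sym (ℚP.*-identityˡ (g 0)))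
  ∏-snoc (suc n) g = trans (cong (g 0 *_) (∏-snoc n (λ x → g (suc x)))) (sym (ℚP.*-assoc (g 0) _ _))

  ∏-ones : ∀ n g → (∀ q → q < n → g q ≡ 1ℚ) → ∏ n g ≡ 1ℚ
  ∏-ones zero    g ones = refl
  ∏-ones (suc n) g ones = cong₂ _*_ (ones 0 (s≤s z≤n)) (∏-ones n _ (λ q q<n → ones (suc q) (s≤s q<n)))

  ∏-extend : ∀ n g → (∀ q → n ≤ q → g q ≡ 1ℚ) → ∀ d → ∏ (n ℕ.+ d) g ≡ ∏ n g
  ∏-extend n g ones zero    = cong (λ m → ∏ m g) (ℕP.+-identityʳ n)
  ∏-extend n g ones (suc d) = trans (cong (λ m → ∏ m g) (ℕP.+-suc n d)) (trans (∏-snoc (n ℕ.+ d) g)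
    (trans (cong₂ _*_ (∏-extend n g ones d) (ones (n ℕ.+ d) (ℕP.m≤m+n n d))) (ℚP.*-identityʳ _)))

  ∏-single : ∀ n g p → p < n → (∀ q → q ≢ p → g q ≡ 1ℚ) → ∏ n g ≡ g p
  ∏-single (suc n) g p p<1+n ones with p ℕP.≟ n
  ... | yes refl = trans (∏-snoc n g) (trans (cong (_* g p)
          (∏-ones n g (λ q q<p → ones q (λ e → ℕP.<-irrefl e q<p)))) (ℚP.*-identityˡ (g p)))
  ... | no p≢n = trans (∏-snoc n g) (trans (cong₂ _*_ (∏-single n g p (ℕP.≤∧≢⇒< (ℕP.≤-pred p<1+n) p≢n) ones)
          (ones n (λ e → p≢n (sym e)))) (ℚP.*-identityʳ (g p)))

  foldr-filter : ∀ {p} {P : Pred ℕ p} (P? : Decidable P) (g : ℕ → ℚ) xs →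
    foldr (λ q acc → g q * acc) 1ℚ (filter P? xs) ≡ foldr (λ q acc → (if does (P? q) then g q else 1ℚ) * acc) 1ℚ xs
  foldr-filter P? g []       = refl
  foldr-filter P? g (x ∷ xs) with does (P? x)
  ... | true  = cong (g x *_) (foldr-filter P? g xs)
  ... | false = trans (foldr-filter P? g xs) (sym (ℚP.*-identityˡ _))

  foldr-applyUpTo : ∀ (g : ℕ → ℚ) f n → foldr (λ q acc → g q * acc) 1ℚ (applyUpTo f n) ≡ ∏ n (λ x → g (f x))
  foldr-applyUpTo g f zero    = refl
  foldr-applyUpTo g f (suc n) = cong (g (f 0) *_) (foldr-applyUpTo g (λ x → f (suc x)) n)

  euler : ℕ → ℕ → ℚ
  euler m q = 1ℚ - (1ℚ ⊘ fromℕ (q ^ m))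

  factor : ℕ → ℕ → ℕ → ℚ
  factor m n q = if does (prime? q ×-dec (q ∣? n)) then euler m q else 1ℚ

  J-∏ : ∀ m n → J m n ≡ fromℕ (n ^ m) * ∏ (suc n) (factor m n)
  J-∏ m n = cong (fromℕ (n ^ m) *_)
    (trans (foldr-filter (λ p → prime? p ×-dec (p ∣? n)) (euler m) (upTo (suc n)))
           (foldr-applyUpTo (factor m n) (λ x → x) (suc n)))

  factor-∣ : ∀ m n q → Prime q → q ∣ n → factor m n q ≡ euler m q
  factor-∣ m n q q-prime q∣n rewrite dec-true (prime? q ×-dec (q ∣? n)) (q-prime , q∣n) = refl

  factor-∤ : ∀ m n q → ¬ (Prime q × q ∣ n) → factor m n q ≡ 1ℚ
  factor-∤ m n q ¬q∣n rewrite dec-false (prime? q ×-dec (q ∣? n)) ¬q∣n = refl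

  prime≢1 : ∀ {q} → Prime q → q ≢ 1
  prime≢1 q-prime = nonTrivial⇒≢1 {{prime⇒nonTrivial q-prime}}

  -- A prime divides a·b for coprime a, b iff it divides exactly one of them.
  factor-* : ∀ m A B → Coprime A B → ∀ q → factor m (A ℕ.* B) q ≡ factor m A q * factor m B q
  factor-* m A B cop q = by-cases (prime? q) (q ∣? A) (q ∣? B)
    where
    by-cases : Dec (Prime q) → Dec (q ∣ A) → Dec (q ∣ B) → factor m (A ℕ.* B) q ≡ factor m A q * factor m B q
    by-cases (no ¬prime) _ _ = trans (factor-∤ m _ q (λ z → ¬prime (proj₁ z)))
      (sym (trans (cong₂ _*_ (factor-∤ m A q (λ z → ¬prime (proj₁ z))) (factor-∤ m B q (λ z → ¬prime (proj₁ z))))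
                  (ℚP.*-identityˡ 1ℚ)))
    by-cases (yes q-prime) (yes q∣A) (yes q∣B) = ⊥-elim (prime≢1 q-prime (cop (q∣A , q∣B)))
    by-cases (yes q-prime) (yes q∣A) (no q∤B) = trans (factor-∣ m _ q q-prime (∣m⇒∣m*n B q∣A))
      (sym (trans (cong₂ _*_ (factor-∣ m A q q-prime q∣A) (factor-∤ m B q (λ z → q∤B (proj₂ z))))
                  (ℚP.*-identityʳ _)))
    by-cases (yes q-prime) (no q∤A) (yes q∣B) = trans (factor-∣ m _ q q-prime (∣n⇒∣m*n A q∣B))
      (sym (trans (cong₂ _*_ (factor-∤ m A q (λ z → q∤A (proj₂ z))) (factor-∣ m B q q-prime q∣B))
                  (ℚP.*-identityˡ _)))
    by-cases (yes q-prime) (no q∤A) (no q∤B) =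
      trans (factor-∤ m _ q (λ z → [ q∤A , q∤B ]′ (euclidsLemma A B q-prime (proj₂ z))))
        (sym (trans (cong₂ _*_ (factor-∤ m A q (λ z → q∤A (proj₂ z))) (factor-∤ m B q (λ z → q∤B (proj₂ z))))
                    (ℚP.*-identityˡ 1ℚ)))

  -- Primes above n do not divide n.
  factor-large : ∀ m n q → 0 < n → suc n ≤ q → factor m n q ≡ 1ℚ
  factor-large m (suc n) q _ n<q = factor-∤ m (suc n) q (λ z → ℕP.<⇒≱ n<q (∣⇒≤ (proj₂ z)))

  ^-distribʳ-* : ∀ a b n → (a ℕ.* b) ^ n ≡ a ^ n ℕ.* b ^ n
  ^-distribʳ-* a b zero    = refl
  ^-distribʳ-* a b (suc n) = trans (cong (a ℕ.* b ℕ.*_) (^-distribʳ-* a b n)) (interchange a b (a ^ n) (b ^ n))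
    where
    interchange : ∀ a b c d → a ℕ.* b ℕ.* (c ℕ.* d) ≡ a ℕ.* c ℕ.* (b ℕ.* d)
    interchange = solveℕ-∀

  J-* : ∀ m A B → Coprime A B → 0 < A → 0 < B → J m (A ℕ.* B) ≡ J m A * J m B
  J-* m A B cop 0<A 0<B = begin
      J m (A ℕ.* B)
    ≡⟨ J-∏ m (A ℕ.* B) ⟩
      fromℕ ((A ℕ.* B) ^ m) * ∏ (suc (A ℕ.* B)) (factor m (A ℕ.* B))
    ≡⟨ cong₂ _*_ (trans (cong fromℕ (^-distribʳ-* A B m)) (fromℕ-* (A ^ m) (B ^ m)))
                 (trans (∏-cong (suc (A ℕ.* B)) (factor-* m A B cop)) (∏-* (suc (A ℕ.* B)) (factor m A) (factor m B))) ⟩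
      fromℕ (A ^ m) * fromℕ (B ^ m) * (∏ (suc (A ℕ.* B)) (factor m A) * ∏ (suc (A ℕ.* B)) (factor m B))
    ≡⟨ cong₂ (λ u v → fromℕ (A ^ m) * fromℕ (B ^ m) * (u * v)) (shrink A B 0<A 0<B)
             (trans (cong (λ z → ∏ (suc z) (factor m B)) (ℕP.*-comm A B)) (shrink B A 0<B 0<A)) ⟩
      fromℕ (A ^ m) * fromℕ (B ^ m) * (∏ (suc A) (factor m A) * ∏ (suc B) (factor m B))
    ≡⟨ interchange (fromℕ (A ^ m)) (fromℕ (B ^ m)) _ _ ⟩
      fromℕ (A ^ m) * ∏ (suc A) (factor m A) * (fromℕ (B ^ m) * ∏ (suc B) (factor m B))
    ≡⟨ cong₂ _*_ (J-∏ m A) (J-∏ m B) ⟨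
      J m A * J m B ∎
    where
    open ≡-Reasoning
    interchange : ∀ a b x y → a * b * (x * y) ≡ a * x * (b * y)
    interchange = solve-∀ ringℚ
    shrink : ∀ A B → 0 < A → 0 < B → ∏ (suc (A ℕ.* B)) (factor m A) ≡ ∏ (suc A) (factor m A)
    shrink A B 0<A (s≤s _) = trans (cong (λ z → ∏ (suc z) (factor m A)) (sym (ℕP.m+[n∸m]≡n (ℕP.m≤m*n A (suc _)))))
      (∏-extend (suc A) (factor m A) (λ q le → factor-large m A q 0<A le) (A ℕ.* B ∸ A))

  prime∣prime^ : ∀ {p q} → Prime q → Prime p → ∀ e → q ∣ p ^ e → q ≡ p
  prime∣prime^ q-prime p-prime zero    q∣1 = ⊥-elim (prime≢1 q-prime (∣1⇒≡1 q∣1))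
  prime∣prime^ {p} q-prime p-prime (suc e) q∣pᵉ⁺¹ with euclidsLemma p (p ^ e) q-prime q∣pᵉ⁺¹
  ... | inj₂ q∣pᵉ = prime∣prime^ q-prime p-prime e q∣pᵉ
  ... | inj₁ q∣p with prime⇒irreducible p-prime q∣p
  ...   | inj₁ q≡1 = ⊥-elim (prime≢1 q-prime q≡1)
  ...   | inj₂ q≡p = q≡p

  J-prime^ : ∀ m p e → Prime p → J m (p ^ suc e) ≡ fromℕ ((p ^ e) ^ m ℕ.* (p ^ m ∸ 1))
  J-prime^ m p e p-prime = begin
      J m (p ^ suc e)
    ≡⟨ J-∏ m (p ^ suc e) ⟩
      fromℕ ((p ^ suc e) ^ m) * ∏ (suc (p ^ suc e)) (factor m (p ^ suc e))
    ≡⟨ cong (fromℕ ((p ^ suc e) ^ m) *_)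
         (∏-single (suc (p ^ suc e)) (factor m (p ^ suc e)) p (s≤s p≤pᵉ⁺¹)
           (λ q q≢p → factor-∤ m _ q (λ z → q≢p (prime∣prime^ (proj₁ z) p-prime (suc e) (proj₂ z))))) ⟩
      fromℕ ((p ^ suc e) ^ m) * factor m (p ^ suc e) p
    ≡⟨ cong₂ (λ u v → fromℕ u * v) (^-distribʳ-* p (p ^ e) m)
             (factor-∣ m _ p p-prime (∣m⇒∣m*n (p ^ e) ∣-refl)) ⟩
      fromℕ (p ^ m ℕ.* (p ^ e) ^ m) * euler m p
    ≡⟨ Euler-factor (p ^ m) ((p ^ e) ^ m) (ℕP.m^n>0 p m) ⟩
      fromℕ ((p ^ e) ^ m ℕ.* (p ^ m ∸ 1)) ∎
    where
    open ≡-Reasoning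
    instance
      p≢0 : ℕ.NonZero p
      p≢0 = prime⇒nonZero p-prime
    p≤pᵉ⁺¹ : p ≤ p ^ suc e
    p≤pᵉ⁺¹ = ℕP.m≤m*n p (p ^ e) {{ℕP.m^n≢0 p e}}

  -- J_m(1) = 1: the product over primes dividing 1 is empty.
  J-1 : ∀ m → J m 1 ≡ 1ℚ
  J-1 m = trans (J-∏ m 1) (trans (cong₂ _*_ (cong fromℕ (ℕP.^-zeroˡ m))
    (∏-ones 2 (factor m 1) (λ q _ → factor-∤ m 1 q (λ z → prime≢1 (proj₁ z) (∣1⇒≡1 (proj₂ z))))))
    (ℚP.*-identityˡ 1ℚ))

module Parity where

  open import Data.Nat as ℕ using (ℕ; zero; suc; _+_; _*_; _^_; _%_)
  open import Data.Nat.Properties using (*-comm; +-identityʳ)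
  open import Data.Nat.DivMod using (%-distribˡ-*; m%n%n≡m%n; [m+kn]%n≡m%n; m*n%n≡0)
  open import Data.Nat.Divisibility using (_∣_; divides)
  open import Data.Nat.Primality using (Prime; prime⇒irreducible)
  open import Data.Product using (Σ; _,_)
  open import Data.Sum using (_⊎_; inj₁; inj₂)
  open import Data.Empty using (⊥-elim)
  open import Relation.Binary.PropositionalEquality
  open import Relation.Nullary using (¬_)
  open import Data.Nat.Tactic.RingSolver using (solve-∀)

  even-or-odd : ∀ n → (Σ ℕ λ q → n ≡ 2 * q) ⊎ (Σ ℕ λ q → n ≡ suc (2 * q))
  even-or-odd zero    = inj₁ (0 , refl)
  even-or-odd (suc n) with even-or-odd n
  ... | inj₁ (q , n≡2q)   = inj₂ (q , cong suc n≡2q)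
  ... | inj₂ (q , n≡2q+1) = inj₁ (suc q , trans (cong suc n≡2q+1) (next q))
    where
    next : ∀ q → suc (suc (2 * q)) ≡ 2 * suc q
    next = solve-∀

  even%2 : ∀ q → (2 * q) % 2 ≡ 0
  even%2 q = trans (cong (_% 2) (*-comm 2 q)) (m*n%n≡0 q 2)

  odd%2 : ∀ q → suc (2 * q) % 2 ≡ 1
  odd%2 q = trans (cong (_% 2) (rearrange q)) ([m+kn]%n≡m%n 1 q 2)
    where
    rearrange : ∀ q → suc (2 * q) ≡ 1 + q * 2
    rearrange = solve-∀

  %2-*-odd : ∀ a m → a % 2 ≡ 1 → (a * m) % 2 ≡ m % 2
  %2-*-odd a m a-odd = trans (%-distribˡ-* a m 2)
    (trans (cong (λ z → (z * (m % 2)) % 2) a-odd) (trans (cong (_% 2) (+-identityʳ (m % 2))) (m%n%n≡m%n m 2)))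

  %2-*-even : ∀ a m → a % 2 ≡ 0 → (a * m) % 2 ≡ 0
  %2-*-even a m a-even = trans (%-distribˡ-* a m 2) (cong (λ z → (z * (m % 2)) % 2) a-even)

  %2-^ : ∀ p e → (p ^ suc e) % 2 ≡ p % 2
  %2-^ p e with even-or-odd p
  ... | inj₁ (q , refl) = trans (%2-*-even (2 * q) ((2 * q) ^ e) (even%2 q)) (sym (even%2 q))
  ... | inj₂ (q , refl) = trans (%2-*-odd (suc (2 * q)) (suc (2 * q) ^ e) (odd%2 q)) (odd-power e)
    where
    odd-power : ∀ e → (suc (2 * q) ^ e) % 2 ≡ suc (2 * q) % 2
    odd-power zero    = sym (odd%2 q)
    odd-power (suc e) = trans (%2-*-odd (suc (2 * q)) (suc (2 * q) ^ e) (odd%2 q)) (odd-power e)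

  prime-2-or-odd : ∀ {p} → Prime p → p ≡ 2 ⊎ (Σ ℕ λ q → p ≡ suc (2 * q))
  prime-2-or-odd {p} p-prime with even-or-odd p
  ... | inj₂ odd = inj₂ odd
  ... | inj₁ (q , p≡2q) with prime⇒irreducible p-prime (divides q (trans p≡2q (*-comm 2 q)))
  ...   | inj₁ ()
  ...   | inj₂ 2≡p = inj₁ (sym 2≡p)

  pred-of-odd : ∀ j → ¬ 2 ∣ suc j → Σ ℕ λ i → j ≡ 2 * i
  pred-of-odd j 2∤1+j with even-or-odd j
  ... | inj₁ even = even
  ... | inj₂ (q , j≡2q+1) = ⊥-elim (2∤1+j (divides (suc q) (trans (cong suc j≡2q+1) (next q))))
    where
    next : ∀ q → suc (suc (2 * q)) ≡ suc q * 2
    next = solve-∀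

module MainFormula where

  open import Data.Nat as ℕ using (ℕ; suc; _+_; _*_; _∸_; _^_; _<_; _≤_; _%_; z≤n; s≤s)
  import Data.Nat.Properties as ℕP
  open import Data.Integer using (0ℤ)
  open import Data.Rational as ℚ using (ℚ; 1ℚ)
  import Data.Rational.Properties as ℚP
  open import Data.Product using (Σ; _,_)
  open import Data.Sum using (_⊎_; inj₁; inj₂)
  open import Relation.Nullary using (contradiction)
  open import Relation.Binary.PropositionalEquality hiding (J)
  open import Data.Nat.Primality using (Prime; prime[2])
  open import Data.Nat.Divisibility using (divides)
  open import Data.Nat.Coprimality using (Coprime)
  open import Tactic.RingSolver using () renaming (solve-∀ to solveℚ-∀)
  open import Data.Nat.Tactic.RingSolver using (solve-∀)
  open import Defs using (Φ; φ; J; fromℕ; _⊘_)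
  open SquareSums using (SqSum)
  open Indicator using (χ; φ-pos)
  open PrimeSums using (SqSum-2)
  open OddPrimeCounts using (N-odd-closed; N-multiple-of-4-closed)
  open ArithmeticFunctions
  open Factorisation
  open Rationals
  open Jordan using (J-*; J-prime^; J-1; ^-distribʳ-*)
  open Parity

  N-odd-prime : ∀ p i → Prime p → SqSum p (suc (2 * i)) (χ p) 0ℤ ≡ (p ∸ 1) * p ^ (2 * i)
  N-odd-prime p i p-prime = by-cases (prime-2-or-odd p-prime)
    where
    by-cases : p ≡ 2 ⊎ (Σ ℕ λ q → p ≡ suc (2 * q)) → SqSum p (suc (2 * i)) (χ p) 0ℤ ≡ (p ∸ 1) * p ^ (2 * i)
    by-cases (inj₁ refl)         = trans (SqSum-2 (2 * i) 0ℤ) (sym (ℕP.*-identityˡ (2 ^ (2 * i))))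
    by-cases (inj₂ (q , p≡2q+1)) = N-odd-closed p q p-prime p≡2q+1 i

  Φ-odd : ∀ i n → 0 < n → Φ (suc (2 * i)) n ≡ n ^ (2 * i) * φ n
  Φ-odd i = multiplicative-agree _*_ (Φ k) (λ n → n ^ (2 * i) * φ n)
    (λ a b 0<a _ cop → Φ-* k a b 0<a cop) rhs-* rhs-1 local
    where
    k : ℕ
    k = suc (2 * i)
    rhs-* : ∀ a b → 0 < a → 0 < b → Coprime a b →
            (a * b) ^ (2 * i) * φ (a * b) ≡ a ^ (2 * i) * φ a * (b ^ (2 * i) * φ b)
    rhs-* a b 0<a _ cop = trans (cong₂ _*_ (^-distribʳ-* a b (2 * i)) (φ-* a b 0<a cop))
                                (interchange (a ^ (2 * i)) (b ^ (2 * i)) (φ a) (φ b))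
      where
      interchange : ∀ x y u v → x * y * (u * v) ≡ x * u * (y * v)
      interchange = solve-∀
    rhs-1 : Φ k 1 ≡ 1 ^ (2 * i) * φ 1
    rhs-1 = trans (Φ-1 k) (sym (cong (_* φ 1) (ℕP.^-zeroˡ (2 * i))))
    local : ∀ p e → Prime p → Φ k (p ^ suc e) ≡ (p ^ suc e) ^ (2 * i) * φ (p ^ suc e)
    local p e p-prime = begin
        Φ k (p ^ suc e)
      ≡⟨ Φ-^ k p e ⟩
        P ^ k * SqSum p k (χ p) 0ℤ
      ≡⟨ cong (P ^ k *_) (N-odd-prime p i p-prime) ⟩
        P * P ^ (2 * i) * ((p ∸ 1) * p ^ (2 * i))
      ≡⟨ rearrange P (P ^ (2 * i)) (p ^ (2 * i)) (p ∸ 1) ⟩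
        p ^ (2 * i) * P ^ (2 * i) * (P * (p ∸ 1))
      ≡⟨ cong₂ _*_ (^-distribʳ-* p P (2 * i)) (φ-prime^ p e p-prime) ⟨
        (p ^ suc e) ^ (2 * i) * φ (p ^ suc e) ∎
      where
      open ≡-Reasoning
      P : ℕ
      P = p ^ e
      rearrange : ∀ P X Y r → P * X * (r * Y) ≡ Y * X * (P * r)
      rearrange = solve-∀

  -- The theorem for k = 4(j + 1), with h = k/2 = 2(j + 1) and h - 1 = 2j + 1.
  module MultipleOfFour (j : ℕ) where

    k : ℕ
    k = 4 * suc j
    h : ℕ
    h = 2 * suc j
    h′ : ℕ
    h′ = suc (2 * j)

    h≡1+h′ : h ≡ suc h′
    h≡1+h′ = ℕP.*-suc 2 j

    k≡h+h : k ≡ h + h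
    k≡h+h = double j
      where
      double : ∀ j → 4 * suc j ≡ 2 * suc j + 2 * suc j
      double = solve-∀

    -- The correction factor 2ʰ/(2ʰ - 1 + (n mod 2)): 1 for odd n, 2ʰ/(2ʰ - 1) for even n.
    c : ℕ → ℚ
    c n = fromℕ (2 ^ h) ⊘ fromℕ (2 ^ h ∸ 1 + n % 2)

    R : ℕ → ℚ
    R n = fromℕ (n ^ (h ∸ 1)) ℚ.* J h n ℚ.* fromℕ (φ n) ℚ.* c n

    2≤2ʰ : 2 ≤ 2 ^ h
    2≤2ʰ = subst (2 ≤_) (sym (cong (2 ^_) h≡1+h′)) (ℕP.*-monoʳ-≤ 2 (ℕP.m^n>0 2 h′))

    c-odd : ∀ n → n % 2 ≡ 1 → c n ≡ 1ℚ
    c-odd n n-odd = begin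
        fromℕ (2 ^ h) ⊘ fromℕ (2 ^ h ∸ 1 + n % 2)  ≡⟨ cong (λ b → fromℕ (2 ^ h) ⊘ fromℕ (2 ^ h ∸ 1 + b)) n-odd ⟩
        fromℕ (2 ^ h) ⊘ fromℕ (2 ^ h ∸ 1 + 1)      ≡⟨ cong (λ m → fromℕ (2 ^ h) ⊘ fromℕ m) (ℕP.m∸n+n≡m 1≤2ʰ) ⟩
        fromℕ (2 ^ h) ⊘ fromℕ (2 ^ h)              ≡⟨ ⊘-self (fromℕ (2 ^ h)) (fromℕ≢0 (2 ^ h) 1≤2ʰ) ⟩
        1ℚ                                          ∎
      where
      open ≡-Reasoning
      1≤2ʰ : 1 ≤ 2 ^ h
      1≤2ʰ = ℕP.≤-trans (s≤s z≤n) 2≤2ʰ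

    c-cong : ∀ m n → m % 2 ≡ n % 2 → c m ≡ c n
    c-cong m n same = cong (λ b → fromℕ (2 ^ h) ⊘ fromℕ (2 ^ h ∸ 1 + b)) same

    -- c is multiplicative on coprime arguments: at most one of them is even.
    c-* : ∀ a b → Coprime a b → c (a * b) ≡ c a ℚ.* c b
    c-* a b cop = by-parity (even-or-odd a) (even-or-odd b)
      where
      open ≡-Reasoning
      by-parity : (Σ ℕ λ q → a ≡ 2 * q) ⊎ (Σ ℕ λ q → a ≡ suc (2 * q)) →
                  (Σ ℕ λ q → b ≡ 2 * q) ⊎ (Σ ℕ λ q → b ≡ suc (2 * q)) → c (a * b) ≡ c a ℚ.* c b
      by-parity (inj₁ (q , a≡2q)) (inj₁ (q′ , b≡2q′)) =
        contradiction (cop (divides q (trans a≡2q (ℕP.*-comm 2 q)) , divides q′ (trans b≡2q′ (ℕP.*-comm 2 q′)))) λ ()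
      by-parity (inj₁ (q , a≡2q)) (inj₂ (q′ , b≡2q′+1)) = begin
          c (a * b)        ≡⟨ c-cong (a * b) a (trans (%2-*-even a b a-even) (sym a-even)) ⟩
          c a              ≡⟨ ℚP.*-identityʳ (c a) ⟨
          c a ℚ.* 1ℚ       ≡⟨ cong (c a ℚ.*_) (c-odd b (trans (cong (_% 2) b≡2q′+1) (odd%2 q′))) ⟨
          c a ℚ.* c b      ∎
        where
        a-even : a % 2 ≡ 0
        a-even = trans (cong (_% 2) a≡2q) (even%2 q)
      by-parity (inj₂ (q , a≡2q+1)) _ = begin
          c (a * b)        ≡⟨ c-cong (a * b) b (%2-*-odd a b a-odd) ⟩
          c b              ≡⟨ ℚP.*-identityˡ (c b) ⟨
          1ℚ ℚ.* c b       ≡⟨ cong (ℚ._* c b) (c-odd a a-odd) ⟨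
          c a ℚ.* c b      ∎
        where
        a-odd : a % 2 ≡ 1
        a-odd = trans (cong (_% 2) a≡2q+1) (odd%2 q)

    R-* : ∀ a b → 0 < a → 0 < b → Coprime a b → R (a * b) ≡ R a ℚ.* R b
    R-* a b 0<a 0<b cop = begin
        fromℕ ((a * b) ^ (h ∸ 1)) ℚ.* J h (a * b) ℚ.* fromℕ (φ (a * b)) ℚ.* c (a * b)
      ≡⟨ cong₂ (λ u v → u ℚ.* v ℚ.* fromℕ (φ (a * b)) ℚ.* c (a * b))
           (trans (cong fromℕ (^-distribʳ-* a b (h ∸ 1))) (fromℕ-* (a ^ (h ∸ 1)) (b ^ (h ∸ 1))))
           (J-* h a b cop 0<a 0<b) ⟩
        fromℕ (a ^ (h ∸ 1)) ℚ.* fromℕ (b ^ (h ∸ 1)) ℚ.* (J h a ℚ.* J h b) ℚ.* fromℕ (φ (a * b)) ℚ.* c (a * b)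
      ≡⟨ cong₂ (λ u v → fromℕ (a ^ (h ∸ 1)) ℚ.* fromℕ (b ^ (h ∸ 1)) ℚ.* (J h a ℚ.* J h b) ℚ.* u ℚ.* v)
           (trans (cong fromℕ (φ-* a b 0<a cop)) (fromℕ-* (φ a) (φ b))) (c-* a b cop) ⟩
        fromℕ (a ^ (h ∸ 1)) ℚ.* fromℕ (b ^ (h ∸ 1)) ℚ.* (J h a ℚ.* J h b) ℚ.* (fromℕ (φ a) ℚ.* fromℕ (φ b))
          ℚ.* (c a ℚ.* c b)
      ≡⟨ regroup (fromℕ (a ^ (h ∸ 1))) (fromℕ (b ^ (h ∸ 1))) (J h a) (J h b) (fromℕ (φ a)) (fromℕ (φ b)) (c a) (c b) ⟩
        R a ℚ.* R b ∎
      where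
      open ≡-Reasoning
      interchange : ∀ x y u v → x ℚ.* y ℚ.* (u ℚ.* v) ≡ x ℚ.* u ℚ.* (y ℚ.* v)
      interchange = solveℚ-∀ ringℚ
      regroup : ∀ x y u v s t w z → x ℚ.* y ℚ.* (u ℚ.* v) ℚ.* (s ℚ.* t) ℚ.* (w ℚ.* z)
                                   ≡ x ℚ.* u ℚ.* s ℚ.* w ℚ.* (y ℚ.* v ℚ.* t ℚ.* z)
      regroup x y u v s t w z =
        trans (cong (λ m → m ℚ.* (s ℚ.* t) ℚ.* (w ℚ.* z)) (interchange x y u v))
          (trans (cong (ℚ._* (w ℚ.* z)) (interchange (x ℚ.* u) (y ℚ.* v) s t))
                 (interchange (x ℚ.* u ℚ.* s) (y ℚ.* v ℚ.* t) w z))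

    R-1 : fromℕ (Φ k 1) ≡ R 1
    R-1 = begin
        fromℕ (Φ k 1)                                   ≡⟨ cong fromℕ (Φ-1 k) ⟩
        1ℚ                                              ≡⟨ ones ⟨
        1ℚ ℚ.* 1ℚ ℚ.* 1ℚ ℚ.* 1ℚ                         ≡⟨ cong₂ (λ u v → fromℕ u ℚ.* v ℚ.* 1ℚ ℚ.* 1ℚ)
                                                             (ℕP.^-zeroˡ (h ∸ 1)) (J-1 h) ⟨
        fromℕ (1 ^ (h ∸ 1)) ℚ.* J h 1 ℚ.* 1ℚ ℚ.* 1ℚ     ≡⟨ cong (fromℕ (1 ^ (h ∸ 1)) ℚ.* J h 1 ℚ.* 1ℚ ℚ.*_)
                                                             (c-odd 1 refl) ⟨
        R 1                                             ∎
      where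
      open ≡-Reasoning
      ones : 1ℚ ℚ.* 1ℚ ℚ.* 1ℚ ℚ.* 1ℚ ≡ 1ℚ
      ones = trans (ℚP.*-identityʳ (1ℚ ℚ.* 1ℚ ℚ.* 1ℚ)) (trans (ℚP.*-identityʳ (1ℚ ℚ.* 1ℚ)) (ℚP.*-identityʳ 1ℚ))

    P^h : ∀ P → P ^ h ≡ P * P ^ h′
    P^h P = cong (P ^_) h≡1+h′

    P^k : ∀ P → P ^ k ≡ P * P ^ h′ * (P * P ^ h′)
    P^k P = trans (cong (P ^_) k≡h+h) (trans (ℕP.^-distribˡ-+-* P h h) (cong₂ _*_ (P^h P) (P^h P)))

    A^[h∸1] : ∀ p e → (p ^ suc e) ^ (h ∸ 1) ≡ p ^ h′ * (p ^ e) ^ h′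
    A^[h∸1] p e = trans (cong ((p ^ suc e) ^_) (cong (_∸ 1) h≡1+h′)) (^-distribʳ-* p (p ^ e) h′)

    fromℕ-*³ : ∀ a b d → fromℕ a ℚ.* fromℕ b ℚ.* fromℕ d ≡ fromℕ (a * b * d)
    fromℕ-*³ a b d = sym (trans (fromℕ-* (a * b) d) (cong (ℚ._* fromℕ d) (fromℕ-* a b)))

    -- Odd prime powers A = pᵉ⁺¹: c(A) = 1 and N(k) = (p - 1)pʰ⁻¹(pʰ - 1).
    local-odd : ∀ p q e → Prime p → p ≡ suc (2 * q) → fromℕ (Φ k (p ^ suc e)) ≡ R (p ^ suc e)
    local-odd p q e p-prime p≡2q+1 = begin
        fromℕ (Φ k A)
      ≡⟨ cong fromℕ count ⟩
        fromℕ (A ^ (h ∸ 1) * (P ^ h * (p ^ h ∸ 1)) * (P * (p ∸ 1)))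
      ≡⟨ fromℕ-*³ (A ^ (h ∸ 1)) (P ^ h * (p ^ h ∸ 1)) (P * (p ∸ 1)) ⟨
        fromℕ (A ^ (h ∸ 1)) ℚ.* fromℕ (P ^ h * (p ^ h ∸ 1)) ℚ.* fromℕ (P * (p ∸ 1))
      ≡⟨ cong₂ (λ u v → fromℕ (A ^ (h ∸ 1)) ℚ.* u ℚ.* fromℕ v) (J-prime^ h p e p-prime) (φ-prime^ p e p-prime) ⟨
        fromℕ (A ^ (h ∸ 1)) ℚ.* J h A ℚ.* fromℕ (φ A)
      ≡⟨ ℚP.*-identityʳ (fromℕ (A ^ (h ∸ 1)) ℚ.* J h A ℚ.* fromℕ (φ A)) ⟨
        fromℕ (A ^ (h ∸ 1)) ℚ.* J h A ℚ.* fromℕ (φ A) ℚ.* 1ℚ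
      ≡⟨ cong (fromℕ (A ^ (h ∸ 1)) ℚ.* J h A ℚ.* fromℕ (φ A) ℚ.*_) (c-odd A A-odd) ⟨
        R A ∎
      where
      open ≡-Reasoning
      A : ℕ
      A = p ^ suc e
      P : ℕ
      P = p ^ e
      A-odd : A % 2 ≡ 1
      A-odd = trans (%2-^ p e) (trans (cong (_% 2) p≡2q+1) (odd%2 q))
      rearrange : ∀ P X Y Z r → P * X * (P * X) * (r * Y * Z) ≡ Y * X * (P * X * Z) * (P * r)
      rearrange = solve-∀
      count : Φ k A ≡ A ^ (h ∸ 1) * (P ^ h * (p ^ h ∸ 1)) * (P * (p ∸ 1))
      count = begin
          Φ k A
        ≡⟨ Φ-^ k p e ⟩
          P ^ k * SqSum p k (χ p) 0ℤ
        ≡⟨ cong₂ _*_ (P^k P) (N-multiple-of-4-closed p q p-prime p≡2q+1 j) ⟩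
          P * P ^ h′ * (P * P ^ h′) * ((p ∸ 1) * p ^ h′ * (p ^ h ∸ 1))
        ≡⟨ rearrange P (P ^ h′) (p ^ h′) (p ^ h ∸ 1) (p ∸ 1) ⟩
          p ^ h′ * P ^ h′ * (P * P ^ h′ * (p ^ h ∸ 1)) * (P * (p ∸ 1))
        ≡⟨ cong₂ (λ u v → u * (v * (p ^ h ∸ 1)) * (P * (p ∸ 1))) (A^[h∸1] p e) (P^h P) ⟨
          A ^ (h ∸ 1) * (P ^ h * (p ^ h ∸ 1)) * (P * (p ∸ 1)) ∎

    -- Powers of two A = 2ᵉ⁺¹: N(k) = 2ᵏ⁻¹ and c(A) = 2ʰ/(2ʰ - 1) cancels the factor 2ʰ - 1 of J.
    local-2 : ∀ e → fromℕ (Φ k (2 ^ suc e)) ≡ R (2 ^ suc e)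
    local-2 e = sym (begin
        R A
      ≡⟨ cong₂ (λ u v → fromℕ (A ^ (h ∸ 1)) ℚ.* u ℚ.* fromℕ v ℚ.* c A)
           (J-prime^ h 2 e prime[2]) (φ-prime^ 2 e prime[2]) ⟩
        fromℕ (A ^ (h ∸ 1)) ℚ.* fromℕ (P ^ h * D) ℚ.* fromℕ (P * 1) ℚ.* c A
      ≡⟨ cong₂ ℚ._*_ (fromℕ-*³ (A ^ (h ∸ 1)) (P ^ h * D) (P * 1))
                     (c-cong A 2 (%2-^ 2 e)) ⟩
        fromℕ (A ^ (h ∸ 1) * (P ^ h * D) * (P * 1)) ℚ.* (fromℕ (2 ^ h) ⊘ fromℕ (D + 0))
      ≡⟨ cong (λ m → fromℕ m ℚ.* (fromℕ (2 ^ h) ⊘ fromℕ (D + 0))) (rearrange (A ^ (h ∸ 1)) (P ^ h) D (P * 1)) ⟩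
        fromℕ (A ^ (h ∸ 1) * P ^ h * (P * 1) * (D + 0)) ℚ.* (fromℕ (2 ^ h) ⊘ fromℕ (D + 0))
      ≡⟨ fromℕ-*-⊘ (A ^ (h ∸ 1) * P ^ h * (P * 1)) (D + 0) (fromℕ (2 ^ h)) D+0>0 ⟩
        fromℕ (A ^ (h ∸ 1) * P ^ h * (P * 1)) ℚ.* fromℕ (2 ^ h)
      ≡⟨ fromℕ-* (A ^ (h ∸ 1) * P ^ h * (P * 1)) (2 ^ h) ⟨
        fromℕ (A ^ (h ∸ 1) * P ^ h * (P * 1) * 2 ^ h)
      ≡⟨ cong fromℕ count ⟨
        fromℕ (Φ k A) ∎)
      where
      open ≡-Reasoning
      A P D : ℕ
      A = 2 ^ suc e
      P = 2 ^ e
      D = 2 ^ h ∸ 1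
      D+0>0 : 0 < D + 0
      D+0>0 = subst (0 <_) (sym (ℕP.+-identityʳ D)) (ℕP.m<n⇒0<n∸m 2≤2ʰ)
      rearrange : ∀ a b d f → a * (b * d) * f ≡ a * b * f * (d + 0)
      rearrange = solve-∀
      regroup : ∀ P X Y N → P * X * (P * X) * (Y * N) ≡ Y * X * (P * X) * (P * 1) * N
      regroup = solve-∀
      count : Φ k A ≡ A ^ (h ∸ 1) * P ^ h * (P * 1) * 2 ^ h
      count = begin
          Φ k A
        ≡⟨ Φ-^ k 2 e ⟩
          P ^ k * SqSum 2 k (χ 2) 0ℤ
        ≡⟨ cong₂ _*_ (P^k P) (trans (cong (λ m → SqSum 2 m (χ 2) 0ℤ) (trans k≡h+h (cong (_+ h) h≡1+h′)))
                                    (trans (SqSum-2 (h′ + h) 0ℤ) (ℕP.^-distribˡ-+-* 2 h′ h))) ⟩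
          P * P ^ h′ * (P * P ^ h′) * (2 ^ h′ * 2 ^ h)
        ≡⟨ regroup P (P ^ h′) (2 ^ h′) (2 ^ h) ⟩
          2 ^ h′ * P ^ h′ * (P * P ^ h′) * (P * 1) * 2 ^ h
        ≡⟨ cong₂ (λ u v → u * v * (P * 1) * 2 ^ h) (A^[h∸1] 2 e) (P^h P) ⟨
          A ^ (h ∸ 1) * P ^ h * (P * 1) * 2 ^ h ∎

    -- Φ_k(n) = nʰ⁻¹·J_h(n)·φ(n)·c(n): both sides are multiplicative and agree on prime powers.
    Φ-formula : ∀ n → 0 < n → fromℕ (Φ k n) ≡ R n
    Φ-formula = multiplicative-agree ℚ._*_ (λ n → fromℕ (Φ k n)) R
      (λ a b 0<a _ cop → trans (cong fromℕ (Φ-* k a b 0<a cop)) (fromℕ-* (Φ k a) (Φ k b))) R-* R-1 local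
      where
      local : ∀ p e → Prime p → fromℕ (Φ k (p ^ suc e)) ≡ R (p ^ suc e)
      local p e p-prime = by-cases (prime-2-or-odd p-prime)
        where
        by-cases : p ≡ 2 ⊎ (Σ ℕ λ q → p ≡ suc (2 * q)) → fromℕ (Φ k (p ^ suc e)) ≡ R (p ^ suc e)
        by-cases (inj₁ p≡2)             = subst (λ p → fromℕ (Φ k (p ^ suc e)) ≡ R (p ^ suc e)) (sym p≡2) (local-2 e)
        by-cases (inj₂ (q , p≡2q+1)) = local-odd p q e p-prime p≡2q+1

    -- For k/4 = j + 1 odd: Φ_k(n)/Φ_{k/4}(n) = n^{k/4}·J_h(n)·c(n), since Φ_{j+1}(n) = nʲφ(n).
    Φ-ratio : ∀ i → j ≡ 2 * i → ∀ n → 0 < n →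
              fromℕ (Φ k n) ⊘ fromℕ (Φ (suc j) n) ≡ fromℕ (n ^ suc j) ℚ.* J h n ℚ.* c n
    Φ-ratio i j≡2i n 0<n = begin
        fromℕ (Φ k n) ⊘ fromℕ (Φ (suc j) n)
      ≡⟨ cong₂ _⊘_ (Φ-formula n 0<n) (cong fromℕ Φ-quarter) ⟩
        R n ⊘ fromℕ (n ^ j * φ n)
      ≡⟨ cong (_⊘ fromℕ (n ^ j * φ n)) R-split ⟩
        (fromℕ (n ^ suc j) ℚ.* J h n ℚ.* c n ℚ.* fromℕ (n ^ j * φ n)) ⊘ fromℕ (n ^ j * φ n)
      ≡⟨ ⊘-cancel (fromℕ (n ^ suc j) ℚ.* J h n ℚ.* c n) (fromℕ (n ^ j * φ n)) (fromℕ≢0 (n ^ j * φ n) denominator>0) ⟩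
        fromℕ (n ^ suc j) ℚ.* J h n ℚ.* c n ∎
      where
      open ≡-Reasoning
      Φ-quarter : Φ (suc j) n ≡ n ^ j * φ n
      Φ-quarter = subst (λ t → Φ (suc t) n ≡ n ^ t * φ n) (sym j≡2i) (Φ-odd i n 0<n)
      denominator>0 : 0 < n ^ j * φ n
      denominator>0 = ℕ.>-nonZero⁻¹ (n ^ j * φ n) {{ℕP.m*n≢0 (n ^ j) (φ n) {{ℕP.m^n≢0 n j {{ℕ.>-nonZero 0<n}}}} {{ℕ.>-nonZero (φ-pos n 0<n)}}}}
      h∸1≡ : h ∸ 1 ≡ suc j + j
      h∸1≡ = trans (cong (_∸ 1) h≡1+h′) (split j)
        where
        split : ∀ j → suc (2 * j) ≡ suc j + j
        split = solve-∀
      regroup : ∀ a b u v w → a ℚ.* b ℚ.* u ℚ.* v ℚ.* w ≡ a ℚ.* u ℚ.* w ℚ.* (b ℚ.* v)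
      regroup = solveℚ-∀ ringℚ
      R-split : R n ≡ fromℕ (n ^ suc j) ℚ.* J h n ℚ.* c n ℚ.* fromℕ (n ^ j * φ n)
      R-split = begin
          fromℕ (n ^ (h ∸ 1)) ℚ.* J h n ℚ.* fromℕ (φ n) ℚ.* c n
        ≡⟨ cong (λ m → fromℕ m ℚ.* J h n ℚ.* fromℕ (φ n) ℚ.* c n)
             (trans (cong (n ^_) h∸1≡) (ℕP.^-distribˡ-+-* n (suc j) j)) ⟩
          fromℕ (n ^ suc j * n ^ j) ℚ.* J h n ℚ.* fromℕ (φ n) ℚ.* c n
        ≡⟨ cong (λ m → m ℚ.* J h n ℚ.* fromℕ (φ n) ℚ.* c n) (fromℕ-* (n ^ suc j) (n ^ j)) ⟩
          fromℕ (n ^ suc j) ℚ.* fromℕ (n ^ j) ℚ.* J h n ℚ.* fromℕ (φ n) ℚ.* c n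
        ≡⟨ regroup (fromℕ (n ^ suc j)) (fromℕ (n ^ j)) (J h n) (fromℕ (φ n)) (c n) ⟩
          fromℕ (n ^ suc j) ℚ.* J h n ℚ.* c n ℚ.* (fromℕ (n ^ j) ℚ.* fromℕ (φ n))
        ≡⟨ cong (fromℕ (n ^ suc j) ℚ.* J h n ℚ.* c n ℚ.*_) (fromℕ-* (n ^ j) (φ n)) ⟨
          fromℕ (n ^ suc j) ℚ.* J h n ℚ.* c n ℚ.* fromℕ (n ^ j * φ n) ∎

open import Defs
open import Data.Nat using (ℕ; _<_; _∸_; _^_; _%_; _/_; _+_)
open import Data.Nat.Divisibility using (_∣_)
open import Data.Product using (_×_)
open import Data.Rational using (ℚ; _*_)
open import Relation.Binary.PropositionalEquality using (_≡_)
open import Relation.Nullary using (¬_)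

open import Data.Nat as ℕ using (zero; suc)
open import Data.Nat.Properties using (*-comm)
open import Data.Nat.DivMod using (m*n/n≡m)
open import Data.Nat.Divisibility using (divides)
open import Data.Product using (_,_)
open import Relation.Binary.PropositionalEquality using (refl; sym; trans; cong)
open import Data.Nat.Tactic.RingSolver using (solve-∀)
open Parity using (pred-of-odd)
open MainFormula using (module MultipleOfFour)

half : ∀ j → suc j ℕ.* 4 / 2 ≡ 2 ℕ.* suc j
half j = trans (cong (_/ 2) (regroup j)) (m*n/n≡m (2 ℕ.* suc j) 2)
  where
  regroup : ∀ j → suc j ℕ.* 4 ≡ 2 ℕ.* suc j ℕ.* 2
  regroup = solve-∀

quarter : ∀ j → suc j ℕ.* 4 / 4 ≡ suc j
quarter j = m*n/n≡m (suc j) 4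

Claims : (n k h q : ℕ) → Set
Claims n k h q =
  (fromℕ (Φ k n) ≡ fromℕ (n ^ (h ∸ 1)) * J h n * fromℕ (φ n) * (fromℕ (2 ^ h) ⊘ fromℕ (2 ^ h ∸ 1 + n % 2)))
  × (¬ (2 ∣ q) → fromℕ (Φ k n) ⊘ fromℕ (Φ q n) ≡ fromℕ (n ^ q) * J h n * (fromℕ (2 ^ h) ⊘ fromℕ (2 ^ h ∸ 1 + n % 2)))

Claims-subst : ∀ {n k k′ h h′ q q′} → k ≡ k′ → h ≡ h′ → q ≡ q′ → Claims n k h q → Claims n k′ h′ q′
Claims-subst refl refl refl claims = claims

-- Write k = 4(j + 1); then h = 2(j + 1), and k/4 = j + 1 is odd exactly when j = 2i.
corollary1 : (k n : ℕ) → 0 < k → 4 ∣ k → 0 < n →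
    (fromℕ (Φ k n) ≡ fromℕ (n ^ (k / 2 ∸ 1)) * J (k / 2) n * fromℕ (φ n)
        * (fromℕ (2 ^ (k / 2)) ⊘ fromℕ (2 ^ (k / 2) ∸ 1 + n % 2)))
    × (¬ (2 ∣ k / 4) →
        fromℕ (Φ k n) ⊘ fromℕ (Φ (k / 4) n) ≡ fromℕ (n ^ (k / 4)) * J (k / 2) n
          * (fromℕ (2 ^ (k / 2)) ⊘ fromℕ (2 ^ (k / 2) ∸ 1 + n % 2)))
corollary1 _ n () (divides zero refl) 0<n
corollary1 _ n 0<k (divides (suc j) refl) 0<n =
  Claims-subst (*-comm 4 (suc j)) (sym (half j)) (sym (quarter j))
    (Φ-formula n 0<n , λ 2∤j+1 → let (i , j≡2i) = pred-of-odd j 2∤j+1 in Φ-ratio i j≡2i n 0<n)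
  where open MultipleOfFour j
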